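{- For every $w\in S_\infty$, write the polynomial $P_w$ as a polynomial in the algebraically independent monomials $T_1,T_2,\dots$ with coefficients polynomials in $x$. Then $P_w=1-P_{w,2}+O(T^3)$, where $O(T^3)$ is a (possibly empty) sum of terms each of which has total degree at least $3$ in the $T_l$'s, and $P_{w,2}$ is a (possibly empty) sum of terms of the form $m^{k,l}_\eta(w)\,x^\eta T_kT_l$ with $k\leq l$, where $\eta=\eta_1+2\eta_2$ is a multi-set with $|\eta_2|\leq k$ and $|\eta_1|+2|\eta_2|=k+l$, and $m^{k,l}_\eta(w)$ is an integer. In other words, the part of $P_w$ of $T$-degree $0$ is $1$, the part of $T$-degree $1$ vanishes, and the part of $T$-degree $2$ has the stated form.
   Context: Permutations in $S_\infty$ compose as functions, $s_i$ is the transposition of $i,i+1$, $\ell(w)$ is the length. For $l\geq1$, $w^l$ is the increasing ordering of $w(1),\dots,w(l)$; $A_l(w)$ is the set of strictly increasing sequences $\alpha$ of $l$ positive integers with $\alpha_j\leq w^l_j$ for all $j$; $s_i\alpha$ is the increasing sequence with entry set $\{s_i(\alpha_j)\}$; $A_{l,i}(w)=\{\alpha\in A_l(w):s_i\alpha\notin A_l(w)\}$. $x^\alpha=\prod_jx_{\alpha_j}$; for a multi-set $\eta$, $x^\eta=\prod_jx_j^{(\text{multiplicity of }j)}$; a multi-set with multiplicities at most 2 is written $\eta=\eta_1+2\eta_2$ with $\eta_1,\eta_2$ the disjoint sets of elements of multiplicity 1 and 2. $T_l=t_1\cdots t_l$. On polynomials in $x$, $s_i$ swaps $x_i,x_{i+1}$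 and $\pi_if=(x_if-x_{i+1}s_if)/(x_i-x_{i+1})$. For $\ell(s_iw)>\ell(w)$, $N_{w,i}=\prod_{l\geq1}\prod_{\alpha\in A_{l,i}(w)}(1-x^{s_i\alpha}T_l)$. $P_w$ is defined by $P_{\mathrm{Id}}=1$ and $P_{s_iw}=\pi_i(P_wN_{w,i})$ whenever $\ell(s_iw)>\ell(w)$ ($\pi_i$ acting on $x$); this is independent of the reduced word used to build $w$. -}

module Defs where

open import Data.Bool using (Bool; true; false; if_then_else_; _∧_; not)
open import Data.Nat using (ℕ; zero; suc; _+_; _*_; _≤_; _<_; _<ᵇ_; _≤ᵇ_; _≡ᵇ_)
import Data.Nat.Properties as ℕP
open import Data.Integer using (ℤ; +_; -_) renaming (_+_ to _+ℤ_; _*_ to _*ℤ_)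
open import Data.Fin using (Fin; toℕ)
open import Data.List using (List; []; _∷_; _++_; map; foldr; concatMap; length; take; filter; sum)
open import Data.Vec using (Vec; tabulate; replicate; zipWith; toList)
open import Data.Vec.Properties using (≡-dec)
open import Data.Product using (_×_; _,_)
open import Relation.Nullary using (does)
open import Relation.Binary.PropositionalEquality using (_≡_)

-- Generic helpers on ℕ and lists (indices of variables are 1-based)

swapℕ : ℕ → ℕ → ℕ
swapℕ i j = if j ≡ᵇ i then suc i else (if j ≡ᵇ suc i then i else j)

range : ℕ → ℕ → List ℕ
range a zero    = []
range a (suc k) = a ∷ range (suc a) k

countEq : ℕ → List ℕ → ℕ
countEq a []       = 0
countEq a (b ∷ bs) = (if a ≡ᵇ b then 1 else 0) + countEq a bs

insert : ℕ → List ℕ → List ℕ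
insert a []       = a ∷ []
insert a (b ∷ bs) = if a ≤ᵇ b then a ∷ b ∷ bs else b ∷ insert a bs

sort : List ℕ → List ℕ
sort = foldr insert []

incSeqs : ℕ → ℕ → ℕ → List (List ℕ)
incSeqs a k       zero    = [] ∷ []
incSeqs a zero    (suc l) = []
incSeqs a (suc k) (suc l) = map (a ∷_) (incSeqs (suc a) k l) ++ incSeqs (suc a) k (suc l)

strictlyIncreasing : List ℕ → Bool
strictlyIncreasing []           = true
strictlyIncreasing (a ∷ [])     = true
strictlyIncreasing (a ∷ b ∷ bs) = (a <ᵇ b) ∧ strictlyIncreasing (b ∷ bs)

allPositive : List ℕ → Bool
allPositive = foldr (λ a r → (0 <ᵇ a) ∧ r) true

pointwiseLeq : List ℕ → List ℕ → Bool
pointwiseLeq []       []       = true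
pointwiseLeq (a ∷ as) (b ∷ bs) = (a ≤ᵇ b) ∧ pointwiseLeq as bs
pointwiseLeq _        _        = false

-- Permutations of S_n in one-line notation [w(1), ..., w(n)]

Perm : Set
Perm = List ℕ

idPerm : ℕ → Perm
idPerm n = range 1 n

-- s_i w = s_i ∘ w (functions compose)
sPerm : ℕ → Perm → Perm
sPerm i w = map (swapℕ i) w

len : Perm → ℕ
len []       = 0
len (a ∷ as) = length (filter (λ b → b Data.Nat.<? a) as) + len as

wl : ℕ → Perm → List ℕ
wl l w = sort (take l w)

inA : ℕ → Perm → List ℕ → Bool
inA l w α = (length α ≡ᵇ l) ∧ strictlyIncreasing α ∧ allPositive α ∧ pointwiseLeq α (wl l w)

sSeq : ℕ → List ℕ → List ℕ
sSeq i α = sort (map (swapℕ i) α)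

-- A_{l,i}(w), for w ∈ S_n (all entries of elements of A_l(w) are ≤ w^l_j ≤ n)
Ali : ℕ → ℕ → Perm → ℕ → List (List ℕ)
Ali n l w i = filter (λ α → Data.Bool._≟_ (inA l w α ∧ not (inA l w (sSeq i α))) true) (incSeqs 1 n l)

-- Polynomials in x_1..x_n and T_1..T_n with integer coefficients,
-- as formal sums of terms c · x^a · T^t (a, t exponent vectors)

Mono : ℕ → Set
Mono n = Vec ℕ n × Vec ℕ n

Poly : ℕ → Set
Poly n = List (ℤ × Mono n)

monoEq : ∀ {n} → Mono n → Mono n → Bool
monoEq (a , t) (b , u) = does (≡-dec ℕP._≟_ a b) ∧ does (≡-dec ℕP._≟_ t u)

coeff : ∀ {n} → Poly n → Mono n → ℤ
coeff []             m = + 0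
coeff ((c , m') ∷ p) m = (if monoEq m' m then c else + 0) +ℤ coeff p m

_≈_ : ∀ {n} → Poly n → Poly n → Set
p ≈ q = ∀ m → coeff p m ≡ coeff q m

zeros : ∀ {n} → Vec ℕ n
zeros = replicate _ 0

term : ∀ {n} → ℤ → Vec ℕ n → Vec ℕ n → Poly n
term c a t = (c , (a , t)) ∷ []

one : ∀ {n} → Poly n
one = term (+ 1) zeros zeros

_⊕_ : ∀ {n} → Poly n → Poly n → Poly n
p ⊕ q = p ++ q

neg : ∀ {n} → Poly n → Poly n
neg = map (λ { (c , m) → (- c , m) })

_⊗_ : ∀ {n} → Poly n → Poly n → Poly n
p ⊗ q = concatMap (λ { (c , (a , t)) → map (λ { (d , (b , u)) → (c *ℤ d , (zipWith _+_ a b , zipWith _+_ t u)) }) q }) p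

unitVec : ∀ {n} → ℕ → Vec ℕ n
unitVec j = tabulate (λ p → if suc (toℕ p) ≡ᵇ j then 1 else 0)

xVar : ∀ {n} → ℕ → Poly n
xVar j = term (+ 1) (unitVec j) zeros

-- exponent vector of x^α for a list α of 1-based indices
xExp : ∀ {n} → List ℕ → Vec ℕ n
xExp α = tabulate (λ p → countEq (suc (toℕ p)) α)

-- exponent of the 1-based variable j in a vector (0 if out of range)
at : ∀ {n} → Vec ℕ n → ℕ → ℕ
at v j = go (toList v) j
  where
  go : List ℕ → ℕ → ℕ
  go []       _             = 0
  go (e ∷ es) zero          = 0
  go (e ∷ es) (suc zero)    = e
  go (e ∷ es) (suc (suc k)) = go es (suc k)

sPoly : ∀ {n} → ℕ → Poly n → Poly n
sPoly i = map (λ { (c , (a , t)) → (c , (tabulate (λ p → at a (swapℕ i (suc (toℕ p)))) , t)) })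

-- g = π_i f, i.e. (x_i - x_{i+1}) g = x_i f - x_{i+1} s_i f
IsPi : ∀ {n} → ℕ → Poly n → Poly n → Set
IsPi i f g = ((xVar i ⊕ neg (xVar (suc i))) ⊗ g) ≈ ((xVar i ⊗ f) ⊕ neg (xVar (suc i) ⊗ sPoly i f))

-- N_{w,i} = ∏_l ∏_{α ∈ A_{l,i}(w)} (1 - x^{s_i α} T_l), for w ∈ S_n, 1 ≤ i < n
-- (for l > n the sets A_{l,i}(w) are empty, so l ranges over 1..n)
Nwi : (n : ℕ) → Perm → ℕ → Poly n
Nwi n w i = foldr (λ l r → foldr (λ α s → (one ⊕ neg (term (+ 1) (xExp (sSeq i α)) (unitVec l))) ⊗ s) r (Ali n l w i)) one (range 1 n)

-- BuildsP n w P : w ∈ S_n is reached from Id by steps w ↦ s_i w with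
-- ℓ(s_i w) > ℓ(w), and P is P_w computed along these steps.
data BuildsP (n : ℕ) : Perm → Poly n → Set where
  base : BuildsP n (idPerm n) one
  step : ∀ {w P Q} (i : ℕ) → 1 ≤ i → suc i ≤ n → len w < len (sPerm i w) →
         BuildsP n w P → IsPi i (P ⊗ Nwi n w i) Q → BuildsP n (sPerm i w) Q

countVal : ∀ {n} → ℕ → Vec ℕ n → ℕ
countVal v a = countEq v (toList a)

allLeq2 : ∀ {n} → Vec ℕ n → Set
allLeq2 a = ∀ j → at a j ≤ 2

-- T-monomial T_k T_l for 0-based positions k, l
TkTl : ∀ {n} → Fin n → Fin n → Vec ℕ n
TkTl k l = zipWith _+_ (unitVec (suc (toℕ k))) (unitVec (suc (toℕ l)))

module Submission where

-- Read coefficient functions as power series in T_1, T_2, … with coefficients in ℤ[x]. The invariant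
-- carried along P ↦ π_i (P · N_{w,i}) is: constant term 1, no linear terms, and quadratic terms
-- x^a T_k T_l only with a of the stated shape.
-- A factor 1 - x^{s_i α} T_l of N_{w,i} has α ∈ A_l(w) but s_i α ∉ A_l(w), which forces i ∈ α and
-- i+1 ∉ α; so x^{s_i α} is squarefree of degree l, contains x_{i+1} and not x_i. Multiplying by such
-- factors only creates linear terms of this kind, and quadratic terms whose x-part is a product of
-- two of them (entries ≤ 2, at most k+1 of them equal to 2). Then π_i sends these linear terms to 0,
-- and replaces x_i^p x_{i+1}^q by monomials x_i^u x_{i+1}^v with u + v = p + q and u, v between p and
-- q, which preserves the quadratic shape.

open import Defs
open import Data.Bool using (true; false; if_then_else_; _∧_; not; T)
open import Data.Bool.Properties using (T-∧; T-≡; T-not-≡)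
open import Data.Empty using (⊥; ⊥-elim)
open import Data.Fin using (Fin; toℕ; fromℕ<) renaming (zero to fzero; suc to fsuc)
import Data.Fin.Properties as Fin
open import Data.Integer using (ℤ; +_; -_) renaming (_+_ to _+ℤ_; _*_ to _*ℤ_)
import Data.Integer.Properties as ℤ
open import Data.List using (List; []; _∷_; _++_; map; foldr; length)



import Data.List.Properties as List
import Data.List.Relation.Unary.All as ListAll
open ListAll using (All)
import Data.List.Relation.Unary.All.Properties as AllP
import Data.List.Relation.Unary.AllPairs as ListAllPairs
open ListAllPairs using (AllPairs)
open import Data.Nat using (ℕ; zero; suc; _+_; _*_; _∸_; _≤_; _<_; z≤n; s≤s; _≤?_; _≡ᵇ_; _<ᵇ_; _≤ᵇ_)
import Data.Nat.Properties as ℕ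
open import Data.Product using (_×_; _,_; proj₁; proj₂; uncurry)
open import Data.Product.Properties using (,-injective)
open import Data.Sum using (_⊎_; inj₁; inj₂)
open import Data.Vec using (Vec; lookup; zipWith; tabulate; sum; _[_]≔_)
  renaming ([] to []ᵥ; _∷_ to _∷ᵥ_; map to mapᵥ)
import Data.Vec.Properties as Vec
open import Data.Vec.Properties using () renaming (≡-dec to ≡ᵥ-dec)
open import Relation.Nullary using (Dec; yes; no; ¬_)
open import Relation.Nullary.Decidable using (dec-true; dec-false; decidable-stable; map′; _×-dec_)
open import Relation.Binary.PropositionalEquality
open import Function using (_∘_; id; flip)
open import Function.Bundles using (Equivalence)
open import Data.Integer.Tactic.RingSolver using (solve-∀)
import Algebra.Properties.CommutativeSemigroup ℕ.+-commutativeSemigroup as ℕ+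
import Algebra.Properties.CommutativeSemigroup ℤ.+-commutativeSemigroup as ℤ+

private variable n : ℕ

≡ᵇ-true : ∀ {m n} → m ≡ n → (m ≡ᵇ n) ≡ true
≡ᵇ-true {m} {n} = dec-true (m ℕ.≟ n)

≡ᵇ-false : ∀ {m n} → m ≢ n → (m ≡ᵇ n) ≡ false
≡ᵇ-false {m} {n} = dec-false (m ℕ.≟ n)

nonzero-summand : ∀ a b c → a +ℤ b +ℤ c ≢ + 0 → a ≢ + 0 ⊎ b ≢ + 0 ⊎ c ≢ + 0
nonzero-summand a b c sum≢0 with a ℤ.≟ + 0 | b ℤ.≟ + 0 | c ℤ.≟ + 0
... | no a≢0 | _ | _ = inj₁ a≢0
... | yes _ | no b≢0 | _ = inj₂ (inj₁ b≢0)
... | yes _ | yes _ | no c≢0 = inj₂ (inj₂ c≢0)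
... | yes refl | yes refl | yes refl = ⊥-elim (sum≢0 refl)

neg≢0 : ∀ {a} → - a ≢ + 0 → a ≢ + 0
neg≢0 -a≢0 refl = -a≢0 refl

nonzero-difference : ∀ a b → a +ℤ - b ≢ + 0 → a ≢ + 0 ⊎ b ≢ + 0
nonzero-difference a b a-b≢0 with a ℤ.≟ + 0 | b ℤ.≟ + 0
... | no a≢0   | _        = inj₁ a≢0
... | yes _    | no b≢0   = inj₂ b≢0
... | yes refl | yes refl = ⊥-elim (a-b≢0 refl)

≡0-stable : ∀ {x} → ¬ x ≢ + 0 → x ≡ + 0
≡0-stable {x} = decidable-stable (x ℤ.≟ + 0)

infixl 6 _+ᵥ_ _∸ᵥ_ _+ₘ_ _∸ₘ_
infix 4 _≤ᵥ_ _≤ₘ_ _≤ᵥ?_ _≤ₘ?_ _≟ₘ_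

_+ᵥ_ _∸ᵥ_ : Vec ℕ n → Vec ℕ n → Vec ℕ n
_+ᵥ_ = zipWith _+_
_∸ᵥ_ = zipWith _∸_

_≤ᵥ_ : Vec ℕ n → Vec ℕ n → Set
a ≤ᵥ b = ∀ p → lookup a p ≤ lookup b p

_≤ᵥ?_ : (a b : Vec ℕ n) → Dec (a ≤ᵥ b)
a ≤ᵥ? b = Fin.all? λ p → lookup a p ≤? lookup b p

lookup-ext : {a b : Vec ℕ n} → (∀ p → lookup a p ≡ lookup b p) → a ≡ b
lookup-ext {a = a} {b} eq =
  trans (sym (Vec.tabulate∘lookup a)) (trans (Vec.tabulate-cong eq) (Vec.tabulate∘lookup b))

lookup-+ᵥ : ∀ (a b : Vec ℕ n) p → lookup (a +ᵥ b) p ≡ lookup a p + lookup b p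
lookup-+ᵥ a b p = Vec.lookup-zipWith _+_ p a b

lookup-∸ᵥ : ∀ (a b : Vec ℕ n) p → lookup (a ∸ᵥ b) p ≡ lookup a p ∸ lookup b p
lookup-∸ᵥ a b p = Vec.lookup-zipWith _∸_ p a b

+ᵥ-comm : (a b : Vec ℕ n) → a +ᵥ b ≡ b +ᵥ a
+ᵥ-comm = Vec.zipWith-comm ℕ.+-comm

m+ᵥn∸ᵥn≡m : (a b : Vec ℕ n) → a +ᵥ b ∸ᵥ b ≡ a
m+ᵥn∸ᵥn≡m a b = lookup-ext λ p → begin
  lookup (a +ᵥ b ∸ᵥ b) p            ≡⟨ lookup-∸ᵥ (a +ᵥ b) b p ⟩
  lookup (a +ᵥ b) p ∸ lookup b p    ≡⟨ cong (_∸ lookup b p) (lookup-+ᵥ a b p) ⟩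
  lookup a p + lookup b p ∸ lookup b p ≡⟨ ℕ.m+n∸n≡m (lookup a p) (lookup b p) ⟩
  lookup a p                        ∎
  where open ≡-Reasoning

m+ᵥn∸ᵥm≡n : (a b : Vec ℕ n) → a +ᵥ b ∸ᵥ a ≡ b
m+ᵥn∸ᵥm≡n a b = trans (cong (_∸ᵥ a) (+ᵥ-comm a b)) (m+ᵥn∸ᵥn≡m b a)

m∸ᵥn+ᵥn≡m : {a b : Vec ℕ n} → b ≤ᵥ a → a ∸ᵥ b +ᵥ b ≡ a
m∸ᵥn+ᵥn≡m {a = a} {b} b≤a = lookup-ext λ p → begin
  lookup (a ∸ᵥ b +ᵥ b) p            ≡⟨ lookup-+ᵥ (a ∸ᵥ b) b p ⟩
  lookup (a ∸ᵥ b) p + lookup b p    ≡⟨ cong (_+ lookup b p) (lookup-∸ᵥ a b p) ⟩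
  lookup a p ∸ lookup b p + lookup b p ≡⟨ ℕ.m∸n+n≡m (b≤a p) ⟩
  lookup a p                        ∎
  where open ≡-Reasoning

∸ᵥ-+ᵥ-assoc : (a b c : Vec ℕ n) → a ∸ᵥ b ∸ᵥ c ≡ a ∸ᵥ (b +ᵥ c)
∸ᵥ-+ᵥ-assoc a b c = lookup-ext λ p → begin
  lookup (a ∸ᵥ b ∸ᵥ c) p                     ≡⟨ lookup-∸ᵥ (a ∸ᵥ b) c p ⟩
  lookup (a ∸ᵥ b) p ∸ lookup c p             ≡⟨ cong (_∸ lookup c p) (lookup-∸ᵥ a b p) ⟩
  lookup a p ∸ lookup b p ∸ lookup c p       ≡⟨ ℕ.∸-+-assoc (lookup a p) (lookup b p) (lookup c p) ⟩
  lookup a p ∸ (lookup b p + lookup c p)     ≡⟨ cong (lookup a p ∸_) (lookup-+ᵥ b c p) ⟨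
  lookup a p ∸ lookup (b +ᵥ c) p             ≡⟨ lookup-∸ᵥ a (b +ᵥ c) p ⟨
  lookup (a ∸ᵥ (b +ᵥ c)) p                   ∎
  where open ≡-Reasoning

n≤ᵥm+ᵥn : (a b : Vec ℕ n) → b ≤ᵥ a +ᵥ b
n≤ᵥm+ᵥn a b p = subst (lookup b p ≤_) (sym (lookup-+ᵥ a b p)) (ℕ.m≤n+m (lookup b p) (lookup a p))

+ᵥ-≤ᵥ⁻ : (a b c : Vec ℕ n) → a +ᵥ b ≤ᵥ c → a ≤ᵥ c × b ≤ᵥ c ∸ᵥ a
+ᵥ-≤ᵥ⁻ a b c ab≤c = (λ p → ℕ.m+n≤o⇒m≤o (lookup a p) (ab≤c′ p)) , λ p →
  subst (lookup b p ≤_) (sym (lookup-∸ᵥ c a p))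
    (subst (_≤ lookup c p ∸ lookup a p) (ℕ.m+n∸m≡n (lookup a p) (lookup b p))
      (ℕ.∸-monoˡ-≤ (lookup a p) (ab≤c′ p)))
  where
  ab≤c′ : ∀ p → lookup a p + lookup b p ≤ lookup c p
  ab≤c′ p = subst (_≤ lookup c p) (lookup-+ᵥ a b p) (ab≤c p)

+ᵥ-≤ᵥ⁺ : (a b c : Vec ℕ n) → a ≤ᵥ c → b ≤ᵥ c ∸ᵥ a → a +ᵥ b ≤ᵥ c
+ᵥ-≤ᵥ⁺ a b c a≤c b≤c-a p = subst (_≤ lookup c p) (sym (lookup-+ᵥ a b p))
  (subst (lookup a p + lookup b p ≤_) (ℕ.m+[n∸m]≡n (a≤c p))
    (ℕ.+-monoʳ-≤ (lookup a p) (subst (lookup b p ≤_) (lookup-∸ᵥ c a p) (b≤c-a p))))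

lookup-zeros : (p : Fin n) → lookup (zeros {n}) p ≡ 0
lookup-zeros p = Vec.lookup-replicate p 0

0≤ᵥm : (a : Vec ℕ n) → zeros ≤ᵥ a
0≤ᵥm a p = subst (_≤ lookup a p) (sym (lookup-zeros p)) z≤n

m∸ᵥ0≡m : (a : Vec ℕ n) → a ∸ᵥ zeros ≡ a
m∸ᵥ0≡m a = lookup-ext λ p → trans (lookup-∸ᵥ a zeros p) (cong (lookup a p ∸_) (lookup-zeros p))

m∸ᵥm≡0 : (a : Vec ℕ n) → a ∸ᵥ a ≡ zeros
m∸ᵥm≡0 a = lookup-ext λ p → trans (lookup-∸ᵥ a a p) (trans (ℕ.n∸n≡0 (lookup a p)) (sym (lookup-zeros p)))

m∸ᵥn≡0⇒m≡n : {a b : Vec ℕ n} → b ≤ᵥ a → a ∸ᵥ b ≡ zeros → a ≡ b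
m∸ᵥn≡0⇒m≡n {a = a} {b} b≤a a∸b≡0 = lookup-ext λ p → ℕ.≤-antisym
  (ℕ.m∸n≡0⇒m≤n (trans (sym (lookup-∸ᵥ a b p)) (trans (cong (λ c → lookup c p) a∸b≡0) (lookup-zeros p))))
  (b≤a p)

_+ₘ_ _∸ₘ_ : Mono n → Mono n → Mono n
(a , t) +ₘ (b , u) = a +ᵥ b , t +ᵥ u
(a , t) ∸ₘ (b , u) = a ∸ᵥ b , t ∸ᵥ u

_≤ₘ_ : Mono n → Mono n → Set
(a , t) ≤ₘ (b , u) = a ≤ᵥ b × t ≤ᵥ u

_≤ₘ?_ : (m m′ : Mono n) → Dec (m ≤ₘ m′)
(a , t) ≤ₘ? (b , u) with a ≤ᵥ? b | t ≤ᵥ? u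
... | yes a≤b | yes t≤u = yes (a≤b , t≤u)
... | no a≰b  | _       = no (a≰b ∘ proj₁)
... | yes _   | no t≰u  = no (t≰u ∘ proj₂)

+ₘ-comm : (m m′ : Mono n) → m +ₘ m′ ≡ m′ +ₘ m
+ₘ-comm (a , t) (b , u) = cong₂ _,_ (+ᵥ-comm a b) (+ᵥ-comm t u)

m+ₘn∸ₘn≡m : (m m′ : Mono n) → m +ₘ m′ ∸ₘ m′ ≡ m
m+ₘn∸ₘn≡m (a , t) (b , u) = cong₂ _,_ (m+ᵥn∸ᵥn≡m a b) (m+ᵥn∸ᵥn≡m t u)

m∸ₘn+ₘn≡m : (m m′ : Mono n) → m′ ≤ₘ m → m ∸ₘ m′ +ₘ m′ ≡ m
m∸ₘn+ₘn≡m _ _ (b≤a , u≤t) = cong₂ _,_ (m∸ᵥn+ᵥn≡m b≤a) (m∸ᵥn+ᵥn≡m u≤t)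

∸ₘ-+ₘ-assoc : (m m₁ m₂ : Mono n) → m ∸ₘ m₁ ∸ₘ m₂ ≡ m ∸ₘ (m₁ +ₘ m₂)
∸ₘ-+ₘ-assoc (a , t) (b , u) (c , v) = cong₂ _,_ (∸ᵥ-+ᵥ-assoc a b c) (∸ᵥ-+ᵥ-assoc t u v)

n≤ₘm+ₘn : (m m′ : Mono n) → m′ ≤ₘ m +ₘ m′
n≤ₘm+ₘn (a , t) (b , u) = n≤ᵥm+ᵥn a b , n≤ᵥm+ᵥn t u

+ₘ-≤ₘ⁻ : (m₁ m₂ m : Mono n) → m₁ +ₘ m₂ ≤ₘ m → m₁ ≤ₘ m × m₂ ≤ₘ m ∸ₘ m₁
+ₘ-≤ₘ⁻ (a , t) (b , u) (c , v) (ab≤c , tu≤v) =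
  (proj₁ (+ᵥ-≤ᵥ⁻ a b c ab≤c) , proj₁ (+ᵥ-≤ᵥ⁻ t u v tu≤v)) ,
  (proj₂ (+ᵥ-≤ᵥ⁻ a b c ab≤c) , proj₂ (+ᵥ-≤ᵥ⁻ t u v tu≤v))

+ₘ-≤ₘ⁺ : (m₁ m₂ m : Mono n) → m₁ ≤ₘ m → m₂ ≤ₘ m ∸ₘ m₁ → m₁ +ₘ m₂ ≤ₘ m
+ₘ-≤ₘ⁺ (a , t) (b , u) (c , v) (a≤c , t≤v) (b≤c∸a , u≤v∸t) =
  +ᵥ-≤ᵥ⁺ a b c a≤c b≤c∸a , +ᵥ-≤ᵥ⁺ t u v t≤v u≤v∸t

zerosₘ : Mono n
zerosₘ = zeros , zeros

0≤ₘm : (m : Mono n) → zerosₘ ≤ₘ m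
0≤ₘm (a , t) = 0≤ᵥm a , 0≤ᵥm t

m∸ₘ0≡m : (m : Mono n) → m ∸ₘ zerosₘ ≡ m
m∸ₘ0≡m (a , t) = cong₂ _,_ (m∸ᵥ0≡m a) (m∸ᵥ0≡m t)

_≟ₘ_ : (m m′ : Mono n) → Dec (m ≡ m′)
(a , t) ≟ₘ (b , u) = map′ (uncurry (cong₂ _,_)) ,-injective (Vec.≡-dec ℕ._≟_ a b ×-dec Vec.≡-dec ℕ._≟_ t u)

monoEq-≡ : {m m′ : Mono n} → m ≡ m′ → monoEq m m′ ≡ true
monoEq-≡ {m = m} {m′} = dec-true (m ≟ₘ m′)

monoEq-≢ : {m m′ : Mono n} → m ≢ m′ → monoEq m m′ ≡ false
monoEq-≢ {m = m} {m′} = dec-false (m ≟ₘ m′)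

coeff-++ : (p q : Poly n) (m : Mono n) → coeff (p ++ q) m ≡ coeff p m +ℤ coeff q m
coeff-++ [] q m = sym (ℤ.+-identityˡ _)
coeff-++ ((c , m′) ∷ p) q m rewrite coeff-++ p q m =
  sym (ℤ.+-assoc (if monoEq m′ m then c else + 0) (coeff p m) (coeff q m))

coeff-neg : (p : Poly n) (m : Mono n) → coeff (neg p) m ≡ - coeff p m
coeff-neg [] m = refl
coeff-neg ((c , m′) ∷ p) m rewrite coeff-neg p m with monoEq m′ m
... | true  = sym (ℤ.neg-distrib-+ c (coeff p m))
... | false = sym (ℤ.neg-distrib-+ (+ 0) (coeff p m))

-- shift G m′ is the coefficient function of x^m′ times a polynomial with coefficient function G.
shift : (Mono n → ℤ) → Mono n → Mono n → ℤ
shift G m′ m with m′ ≤ₘ? m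
... | yes _ = G (m ∸ₘ m′)
... | no _  = + 0

convolve : (Mono n → ℤ) → Poly n → Mono n → ℤ
convolve G []              m = + 0
convolve G ((d , m′) ∷ q) m = d *ℤ shift G m′ m +ℤ convolve G q m

shift-coeff-∷ : ∀ (c : ℤ) (m₁ : Mono n) (p : Poly n) (m₂ m : Mono n) →
  shift (coeff ((c , m₁) ∷ p)) m₂ m ≡ (if monoEq (m₁ +ₘ m₂) m then c else + 0) +ℤ shift (coeff p) m₂ m
shift-coeff-∷ c m₁ p m₂ m with m₂ ≤ₘ? m
... | no m₂≰m = cong (λ b → (if b then c else + 0) +ℤ + 0)
                     (sym (monoEq-≢ {m = m₁ +ₘ m₂} {m} λ eq → m₂≰m (subst (m₂ ≤ₘ_) eq (n≤ₘm+ₘn m₁ m₂))))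
... | yes m₂≤m with m₁ ≟ₘ (m ∸ₘ m₂)
...   | yes refl = cong (λ b → (if b then c else + 0) +ℤ coeff p (m ∸ₘ m₂))
                        (trans (monoEq-≡ {m = m ∸ₘ m₂} refl) (sym (monoEq-≡ (m∸ₘn+ₘn≡m m m₂ m₂≤m))))
...   | no m₁≢m∸m₂ = cong (λ b → (if b then c else + 0) +ℤ coeff p (m ∸ₘ m₂))
                          (trans (monoEq-≢ m₁≢m∸m₂) (sym (monoEq-≢ {m = m₁ +ₘ m₂} {m} m₁+m₂≢m)))
  where
  m₁+m₂≢m : m₁ +ₘ m₂ ≢ m
  m₁+m₂≢m eq = m₁≢m∸m₂ (trans (sym (m+ₘn∸ₘn≡m m₁ m₂)) (cong (_∸ₘ m₂) eq))

if-*ˡ : ∀ b (c d : ℤ) → d *ℤ (if b then c else + 0) ≡ (if b then c *ℤ d else + 0)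
if-*ˡ true  c d = ℤ.*-comm d c
if-*ˡ false c d = ℤ.*-zeroʳ d

coeff-single-⊗ : ∀ (c : ℤ) (a t : Vec ℕ n) (q : Poly n) m →
  coeff (((c , (a , t)) ∷ []) ⊗ q) m ≡ c *ℤ shift (coeff q) (a , t) m
coeff-single-⊗ c a t [] m with (a , t) ≤ₘ? m
... | yes _ = sym (ℤ.*-zeroʳ c)
... | no _  = sym (ℤ.*-zeroʳ c)
coeff-single-⊗ c a t ((d , (b , u)) ∷ q) m = begin
  I (c *ℤ d) +ℤ coeff (((c , (a , t)) ∷ []) ⊗ q) m
    ≡⟨ cong₂ _+ℤ_ first-term (coeff-single-⊗ c a t q m) ⟩
  c *ℤ I′ d +ℤ c *ℤ shift (coeff q) (a , t) m
    ≡⟨ ℤ.*-distribˡ-+ c _ _ ⟨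
  c *ℤ (I′ d +ℤ shift (coeff q) (a , t) m)
    ≡⟨ cong (c *ℤ_) (shift-coeff-∷ d (b , u) q (a , t) m) ⟨
  c *ℤ shift (coeff ((d , (b , u)) ∷ q)) (a , t) m ∎
  where
  open ≡-Reasoning
  I I′ : ℤ → ℤ
  I x = if monoEq ((a , t) +ₘ (b , u)) m then x else + 0
  I′ x = if monoEq ((b , u) +ₘ (a , t)) m then x else + 0
  first-term : I (c *ℤ d) ≡ c *ℤ I′ d
  first-term = begin
    I (c *ℤ d)  ≡⟨ cong (λ m′ → if monoEq m′ m then c *ℤ d else + 0) (+ₘ-comm (a , t) (b , u)) ⟩
    I′ (c *ℤ d)  ≡⟨ cong I′ (ℤ.*-comm c d) ⟩
    I′ (d *ℤ c)  ≡⟨ if-*ˡ (monoEq ((b , u) +ₘ (a , t)) m) d c ⟨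
    c *ℤ I′ d    ∎

shift-+ₘ : ∀ (G : Mono n → ℤ) m₁ m₂ m → shift G (m₁ +ₘ m₂) m ≡ shift (shift G m₂) m₁ m
shift-+ₘ G m₁ m₂ m with m₁ +ₘ m₂ ≤ₘ? m | m₁ ≤ₘ? m
... | no _ | no _ = refl
... | yes m₁₂≤m | no m₁≰m = ⊥-elim (m₁≰m (proj₁ (+ₘ-≤ₘ⁻ m₁ m₂ m m₁₂≤m)))
... | yes m₁₂≤m | yes _ with m₂ ≤ₘ? m ∸ₘ m₁
...   | yes _ = cong G (sym (∸ₘ-+ₘ-assoc m m₁ m₂))
...   | no m₂≰m∸m₁ = ⊥-elim (m₂≰m∸m₁ (proj₂ (+ₘ-≤ₘ⁻ m₁ m₂ m m₁₂≤m)))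
shift-+ₘ G m₁ m₂ m | no m₁₂≰m | yes m₁≤m with m₂ ≤ₘ? m ∸ₘ m₁
...   | yes m₂≤m∸m₁ = ⊥-elim (m₁₂≰m (+ₘ-≤ₘ⁺ m₁ m₂ m m₁≤m m₂≤m∸m₁))
...   | no _ = refl

shift-linear : ∀ (H A B : Mono n → ℤ) d m₁ m → (∀ m′ → H m′ ≡ d *ℤ A m′ +ℤ B m′) →
  shift H m₁ m ≡ d *ℤ shift A m₁ m +ℤ shift B m₁ m
shift-linear H A B d m₁ m H≗dA+B with m₁ ≤ₘ? m
... | yes _ = H≗dA+B _
... | no _  = sym (trans (ℤ.+-identityʳ _) (ℤ.*-zeroʳ d))

shift-zerosₘ : ∀ (H : Mono n → ℤ) m → shift H zerosₘ m ≡ H m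
shift-zerosₘ H m with zerosₘ ≤ₘ? m
... | yes _ = cong H (m∸ₘ0≡m m)
... | no 0≰m = ⊥-elim (0≰m (0≤ₘm m))

shift-nonzero : ∀ (G : Mono n → ℤ) m′ m → shift G m′ m ≢ + 0 → m′ ≤ₘ m × G (m ∸ₘ m′) ≢ + 0
shift-nonzero G m′ m shift≢0 with m′ ≤ₘ? m
... | yes m′≤m = m′≤m , shift≢0
... | no _     = ⊥-elim (shift≢0 refl)

convolve-++ : ∀ G (p q : Poly n) m → convolve G (p ++ q) m ≡ convolve G p m +ℤ convolve G q m
convolve-++ G [] q m = sym (ℤ.+-identityˡ _)
convolve-++ G ((d , m′) ∷ p) q m rewrite convolve-++ G p q m =
  sym (ℤ.+-assoc (d *ℤ shift G m′ m) (convolve G p m) (convolve G q m))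

⊗-∷ : ∀ (x : ℤ × Mono n) (p q : Poly n) → (x ∷ p) ⊗ q ≡ ((x ∷ []) ⊗ q) ++ (p ⊗ q)
⊗-∷ x p q = cong (_++ (p ⊗ q)) (sym (List.++-identityʳ _))

convolve-coeff-∷ : ∀ (c : ℤ) (a t : Vec ℕ n) (p q : Poly n) m →
  convolve (coeff ((c , (a , t)) ∷ p)) q m ≡ coeff (((c , (a , t)) ∷ []) ⊗ q) m +ℤ convolve (coeff p) q m
convolve-coeff-∷ c a t p [] m = refl
convolve-coeff-∷ c a t p ((d , (b , u)) ∷ q) m = begin
  d *ℤ shift (coeff ((c , (a , t)) ∷ p)) (b , u) m +ℤ convolve (coeff ((c , (a , t)) ∷ p)) q m
    ≡⟨ cong₂ _+ℤ_ (cong (d *ℤ_) (shift-coeff-∷ c (a , t) p (b , u) m)) (convolve-coeff-∷ c a t p q m) ⟩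
  d *ℤ (I c +ℤ shift (coeff p) (b , u) m) +ℤ (coeff (((c , (a , t)) ∷ []) ⊗ q) m +ℤ convolve (coeff p) q m)
    ≡⟨ cong (_+ℤ _) (trans (ℤ.*-distribˡ-+ d _ _) (cong (_+ℤ _) (if-*ˡ (monoEq ((a , t) +ₘ (b , u)) m) c d))) ⟩
  (I (c *ℤ d) +ℤ d *ℤ shift (coeff p) (b , u) m) +ℤ (coeff (((c , (a , t)) ∷ []) ⊗ q) m +ℤ convolve (coeff p) q m)
    ≡⟨ ℤ+.interchange (I (c *ℤ d)) _ (coeff (((c , (a , t)) ∷ []) ⊗ q) m) _ ⟩
  (I (c *ℤ d) +ℤ coeff (((c , (a , t)) ∷ []) ⊗ q) m) +ℤ
    (d *ℤ shift (coeff p) (b , u) m +ℤ convolve (coeff p) q m) ∎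
  where
  open ≡-Reasoning
  I : ℤ → ℤ
  I x = if monoEq ((a , t) +ₘ (b , u)) m then x else + 0

shift-zero : ∀ (H : Mono n → ℤ) m′ m → (∀ m″ → H m″ ≡ + 0) → shift H m′ m ≡ + 0
shift-zero H m′ m H≗0 with m′ ≤ₘ? m
... | yes _ = H≗0 _
... | no _  = refl

convolve-[] : ∀ (q : Poly n) m → convolve (coeff []) q m ≡ + 0
convolve-[] [] m = refl
convolve-[] ((d , m′) ∷ q) m =
  cong₂ _+ℤ_ (trans (cong (d *ℤ_) (shift-zero (coeff []) m′ m (λ _ → refl))) (ℤ.*-zeroʳ d)) (convolve-[] q m)

coeff-⊗ : ∀ (p q : Poly n) m → coeff (p ⊗ q) m ≡ convolve (coeff p) q m
coeff-⊗ [] q m = sym (convolve-[] q m)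
coeff-⊗ ((c , (a , t)) ∷ p) q m = begin
  coeff (((c , (a , t)) ∷ p) ⊗ q) m
    ≡⟨ cong (λ r → coeff r m) (⊗-∷ (c , (a , t)) p q) ⟩
  coeff (((c , (a , t)) ∷ []) ⊗ q ++ p ⊗ q) m
    ≡⟨ coeff-++ (((c , (a , t)) ∷ []) ⊗ q) (p ⊗ q) m ⟩
  coeff (((c , (a , t)) ∷ []) ⊗ q) m +ℤ coeff (p ⊗ q) m
    ≡⟨ cong (coeff (((c , (a , t)) ∷ []) ⊗ q) m +ℤ_) (coeff-⊗ p q m) ⟩
  coeff (((c , (a , t)) ∷ []) ⊗ q) m +ℤ convolve (coeff p) q m
    ≡⟨ convolve-coeff-∷ c a t p q m ⟨
  convolve (coeff ((c , (a , t)) ∷ p)) q m ∎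
  where open ≡-Reasoning

convolve-single-⊗ : ∀ G (c : ℤ) (a t : Vec ℕ n) (s : Poly n) m →
  convolve G (((c , (a , t)) ∷ []) ⊗ s) m ≡ c *ℤ shift (convolve G s) (a , t) m
convolve-single-⊗ G c a t [] m =
  sym (trans (cong (c *ℤ_) (shift-zero (convolve G []) (a , t) m (λ _ → refl))) (ℤ.*-zeroʳ c))
convolve-single-⊗ G c a t ((d , (b , u)) ∷ s) m = begin
  (c *ℤ d) *ℤ shift G ((a , t) +ₘ (b , u)) m +ℤ convolve G (((c , (a , t)) ∷ []) ⊗ s) m
    ≡⟨ cong₂ (λ x y → (c *ℤ d) *ℤ x +ℤ y) (shift-+ₘ G (a , t) (b , u) m) (convolve-single-⊗ G c a t s m) ⟩
  (c *ℤ d) *ℤ shift (shift G (b , u)) (a , t) m +ℤ c *ℤ shift (convolve G s) (a , t) m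
    ≡⟨ factor-out c d _ _ ⟩
  c *ℤ (d *ℤ shift (shift G (b , u)) (a , t) m +ℤ shift (convolve G s) (a , t) m)
    ≡⟨ cong (c *ℤ_) (shift-linear (convolve G ((d , (b , u)) ∷ s)) (shift G (b , u)) (convolve G s) d (a , t) m
                                  (λ _ → refl)) ⟨
  c *ℤ shift (convolve G ((d , (b , u)) ∷ s)) (a , t) m ∎
  where
  open ≡-Reasoning
  factor-out : ∀ c d x y → (c *ℤ d) *ℤ x +ℤ c *ℤ y ≡ c *ℤ (d *ℤ x +ℤ y)
  factor-out = solve-∀

convolve-one : ∀ (G : Mono n → ℤ) m → convolve G one m ≡ G m
convolve-one G m = trans (ℤ.+-identityʳ _) (trans (ℤ.*-identityˡ _) (shift-zerosₘ G m))

private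
  difference : ∀ x y → + 1 *ℤ x +ℤ - + 1 *ℤ y ≡ x +ℤ - y
  difference = solve-∀

convolve-factor : ∀ G (β u : Vec ℕ n) (s : Poly n) m →
  convolve G ((one ⊕ neg (term (+ 1) β u)) ⊗ s) m ≡ convolve G s m +ℤ - shift (convolve G s) (β , u) m
convolve-factor G β u s m = begin
  convolve G ((one ⊕ neg (term (+ 1) β u)) ⊗ s) m
    ≡⟨ cong (λ r → convolve G r m) (⊗-∷ (+ 1 , zerosₘ) ((- + 1 , (β , u)) ∷ []) s) ⟩
  convolve G (((+ 1 , zerosₘ) ∷ []) ⊗ s ++ ((- + 1 , (β , u)) ∷ []) ⊗ s) m
    ≡⟨ convolve-++ G (((+ 1 , zerosₘ) ∷ []) ⊗ s) (((- + 1 , (β , u)) ∷ []) ⊗ s) m ⟩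
  convolve G (((+ 1 , zerosₘ) ∷ []) ⊗ s) m +ℤ convolve G (((- + 1 , (β , u)) ∷ []) ⊗ s) m
    ≡⟨ cong₂ _+ℤ_ (convolve-single-⊗ G (+ 1) zeros zeros s m) (convolve-single-⊗ G (- + 1) β u s m) ⟩
  + 1 *ℤ shift (convolve G s) zerosₘ m +ℤ - + 1 *ℤ shift (convolve G s) (β , u) m
    ≡⟨ cong (λ x → + 1 *ℤ x +ℤ - + 1 *ℤ shift (convolve G s) (β , u) m) (shift-zerosₘ (convolve G s) m) ⟩
  + 1 *ℤ convolve G s m +ℤ - + 1 *ℤ shift (convolve G s) (β , u) m
    ≡⟨ difference (convolve G s m) (shift (convolve G s) (β , u) m) ⟩
  convolve G s m +ℤ - shift (convolve G s) (β , u) m ∎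
  where open ≡-Reasoning

coeff-binomial-⊗ : ∀ (a b : Vec ℕ n) (q : Poly n) m →
  coeff ((term (+ 1) a zeros ⊕ neg (term (+ 1) b zeros)) ⊗ q) m
    ≡ shift (coeff q) (a , zeros) m +ℤ - shift (coeff q) (b , zeros) m
coeff-binomial-⊗ a b q m = begin
  coeff ((term (+ 1) a zeros ⊕ neg (term (+ 1) b zeros)) ⊗ q) m
    ≡⟨ cong (λ r → coeff r m) (⊗-∷ (+ 1 , (a , zeros)) ((- + 1 , (b , zeros)) ∷ []) q) ⟩
  coeff (((+ 1 , (a , zeros)) ∷ []) ⊗ q ++ ((- + 1 , (b , zeros)) ∷ []) ⊗ q) m
    ≡⟨ coeff-++ (((+ 1 , (a , zeros)) ∷ []) ⊗ q) (((- + 1 , (b , zeros)) ∷ []) ⊗ q) m ⟩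
  coeff (((+ 1 , (a , zeros)) ∷ []) ⊗ q) m +ℤ coeff (((- + 1 , (b , zeros)) ∷ []) ⊗ q) m
    ≡⟨ cong₂ _+ℤ_ (coeff-single-⊗ (+ 1) a zeros q m) (coeff-single-⊗ (- + 1) b zeros q m) ⟩
  + 1 *ℤ shift (coeff q) (a , zeros) m +ℤ - + 1 *ℤ shift (coeff q) (b , zeros) m
    ≡⟨ difference (shift (coeff q) (a , zeros) m) (shift (coeff q) (b , zeros) m) ⟩
  shift (coeff q) (a , zeros) m +ℤ - shift (coeff q) (b , zeros) m ∎
  where open ≡-Reasoning

indicator : ℕ → ℕ → ℕ
indicator c x = if c ≡ᵇ x then 1 else 0

countVal-sum : ∀ c (a : Vec ℕ n) → countVal c a ≡ sum (mapᵥ (indicator c) a)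
countVal-sum c []ᵥ       = refl
countVal-sum c (x ∷ᵥ a) = cong (_+_ (indicator c x)) (countVal-sum c a)

sum-+ᵥ : (a b : Vec ℕ n) → sum (a +ᵥ b) ≡ sum a + sum b
sum-+ᵥ []ᵥ       []ᵥ       = refl
sum-+ᵥ (x ∷ᵥ a) (y ∷ᵥ b) = trans (cong (_+_ (x + y)) (sum-+ᵥ a b)) (ℕ+.interchange x y (sum a) (sum b))

sum-map-[]≔ : ∀ f (a : Vec ℕ n) k x → sum (mapᵥ f (a [ k ]≔ x)) + f (lookup a k) ≡ sum (mapᵥ f a) + f x
sum-map-[]≔ f (y ∷ᵥ a) fzero    x = ℕ+.xy∙z≈zy∙x (f x) (sum (mapᵥ f a)) (f y)
sum-map-[]≔ f (y ∷ᵥ a) (fsuc k) x = begin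
  f y + sum (mapᵥ f (a [ k ]≔ x)) + f (lookup a k)   ≡⟨ ℕ.+-assoc (f y) _ _ ⟩
  f y + (sum (mapᵥ f (a [ k ]≔ x)) + f (lookup a k)) ≡⟨ cong (_+_ (f y)) (sum-map-[]≔ f a k x) ⟩
  f y + (sum (mapᵥ f a) + f x)                       ≡⟨ ℕ.+-assoc (f y) _ _ ⟨
  f y + sum (mapᵥ f a) + f x                         ∎
  where open ≡-Reasoning

sum-tabulate-0 : sum (tabulate {n = n} (λ _ → 0)) ≡ 0
sum-tabulate-0 {zero}  = refl
sum-tabulate-0 {suc n} = sum-tabulate-0 {n}

sum-unitVec : ∀ x → 1 ≤ x → x ≤ n → sum (unitVec {n} x) ≡ 1
sum-unitVec {suc n} (suc zero)    _ _          = cong suc (sum-tabulate-0 {n})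
sum-unitVec {suc n} (suc (suc x)) _ (s≤s x<n) = sum-unitVec {n} (suc x) (s≤s z≤n) x<n

-- x_i^u x_{i+1}^v occurs in π_i (x_i^p x_{i+1}^q), where u + v = p + q, only if u and v both lie
-- between q and p: in the closed interval when q ≤ p, in the open one when p < q.
InPiRange : ℕ → ℕ → ℕ → Set
InPiRange p u v = (u ≤ p × v ≤ p) ⊎ (p < u × p < v)

inPiRange-sym : ∀ {p u v} → InPiRange p u v → InPiRange p v u
inPiRange-sym (inj₁ (u≤p , v≤p)) = inj₁ (v≤p , u≤p)
inPiRange-sym (inj₂ (p<u , p<v)) = inj₂ (p<v , p<u)

inPiRange-toward-diagonal : ∀ {p u v} → v ≤ u → InPiRange p (suc u) v → InPiRange p u (suc v)
inPiRange-toward-diagonal v≤u (inj₁ (1+u≤p , _))  = inj₁ (ℕ.<⇒≤ 1+u≤p , ℕ.≤-trans (s≤s v≤u) 1+u≤p)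
inPiRange-toward-diagonal v≤u (inj₂ (_ , p<v)) = inj₂ (ℕ.<-≤-trans p<v v≤u , ℕ.m<n⇒m<1+n p<v)

inPiRange-upper : ∀ {p q u v} → p + q ≡ u + v → p < v → u < q
inPiRange-upper {p} {q} {u} {v} sum-eq p<v with u ℕ.<? q
... | yes u<q = u<q
... | no u≮q  = ⊥-elim (ℕ.<-irrefl (trans sum-eq (ℕ.+-comm u v)) (ℕ.+-mono-<-≤ p<v (ℕ.≮⇒≥ u≮q)))

inPiRange-0-1 : ∀ {p q u v} → p ≡ 0 → q ≡ 1 → p + q ≡ u + v → ¬ InPiRange p u v
inPiRange-0-1 refl refl sum-eq (inj₁ (u≤0 , v≤0))
  rewrite ℕ.n≤0⇒n≡0 u≤0 | ℕ.n≤0⇒n≡0 v≤0 = ℕ.1+n≢0 sum-eq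
inPiRange-0-1 refl refl sum-eq (inj₂ (0<u , 0<v)) = ℕ.<-irrefl sum-eq (ℕ.+-mono-≤ 0<u 0<v)

indicator2-≤1 : ∀ {x} → x ≤ 1 → indicator 2 x ≡ 0
indicator2-≤1 z≤n       = refl
indicator2-≤1 (s≤s z≤n) = refl

indicator2-mono : ∀ {x p} → x ≤ p → p ≤ 2 → indicator 2 x ≤ indicator 2 p
indicator2-mono {x} {p} x≤p p≤2 with x ℕ.≟ 2
... | yes refl rewrite ℕ.≤-antisym p≤2 x≤p = ℕ.≤-refl
... | no x≢2   rewrite ≡ᵇ-false (x≢2 ∘ sym) = z≤n

inPiRange-twos : ∀ {p q u v} → p ≤ 2 → q ≤ 2 → p + q ≡ u + v → InPiRange p u v →
  u ≤ 2 × v ≤ 2 × indicator 2 u + indicator 2 v ≤ indicator 2 p + indicator 2 q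
inPiRange-twos {p} {q} {u} {v} p≤2 q≤2 sum-eq (inj₁ (u≤p , v≤p)) =
  ℕ.≤-trans u≤p p≤2 , ℕ.≤-trans v≤p p≤2 , twos
  where
  twos : indicator 2 u + indicator 2 v ≤ indicator 2 p + indicator 2 q
  twos with u ℕ.≟ 2
  ... | yes refl rewrite ℕ.≤-antisym p≤2 u≤p | ℕ.+-cancelˡ-≡ 2 q v sum-eq = ℕ.≤-refl
  ... | no u≢2   rewrite ≡ᵇ-false (u≢2 ∘ sym) = ℕ.≤-trans (indicator2-mono v≤p p≤2) (ℕ.m≤m+n _ _)
inPiRange-twos {p} {q} {u} {v} p≤2 q≤2 sum-eq (inj₂ (p<u , p<v)) =
  ℕ.m≤n⇒m≤1+n u≤1 , ℕ.m≤n⇒m≤1+n v≤1 ,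
  subst (_≤ indicator 2 p + indicator 2 q) (sym (cong₂ _+_ (indicator2-≤1 u≤1) (indicator2-≤1 v≤1))) z≤n
  where
  u≤1 : u ≤ 1
  u≤1 = ℕ.≤-pred (ℕ.<-≤-trans (inPiRange-upper sum-eq p<v) q≤2)
  v≤1 : v ≤ 1
  v≤1 = ℕ.≤-pred (ℕ.<-≤-trans (inPiRange-upper (trans sum-eq (ℕ.+-comm u v)) p<u) q≤2)

record PiSource (F : ℕ → ℕ → ℤ) (u v : ℕ) : Set where
  constructor source
  field
    p q      : ℕ
    sum-eq   : p + q ≡ u + v
    in-range : InPiRange p u v
    nonzero  : F p q ≢ + 0

-- Q u v and F u v stand for the coefficients of x_i^u x_{i+1}^v in Q = π_i F and in F, all other
-- exponents being fixed; the hypotheses are (x_i - x_{i+1}) Q = x_i F - x_{i+1} s_i F, coefficientwise.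
module DividedDifference (Q F : ℕ → ℕ → ℤ)
  (bottom-edge : ∀ u → Q u 0 ≡ F u 0)
  (left-edge   : ∀ v → Q 0 v ≡ F v 0)
  (interior    : ∀ u v → Q u (suc v) +ℤ - Q (suc u) v ≡ F u (suc v) +ℤ - F v (suc u)) where

  private
    step-down : ∀ u v → Q u (suc v) ≡ F u (suc v) +ℤ - F v (suc u) +ℤ Q (suc u) v
    step-down u v = begin
      Q u (suc v)                                   ≡⟨ cancel (Q u (suc v)) (Q (suc u) v) ⟩
      Q u (suc v) +ℤ - Q (suc u) v +ℤ Q (suc u) v   ≡⟨ cong (_+ℤ Q (suc u) v) (interior u v) ⟩
      F u (suc v) +ℤ - F v (suc u) +ℤ Q (suc u) v   ∎
      where
      open ≡-Reasoning
      cancel : ∀ a b → a ≡ a +ℤ - b +ℤ b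
      cancel = solve-∀

    step-up : ∀ u v → Q (suc u) v ≡ Q u (suc v) +ℤ - F u (suc v) +ℤ F v (suc u)
    step-up u v = begin
      Q (suc u) v                                             ≡⟨ cancel (Q u (suc v)) (Q (suc u) v) ⟩
      Q u (suc v) +ℤ - (Q u (suc v) +ℤ - Q (suc u) v)         ≡⟨ cong (λ d → Q u (suc v) +ℤ - d) (interior u v) ⟩
      Q u (suc v) +ℤ - (F u (suc v) +ℤ - F v (suc u))         ≡⟨ expand (Q u (suc v)) (F u (suc v)) (F v (suc u)) ⟩
      Q u (suc v) +ℤ - F u (suc v) +ℤ F v (suc u)             ∎
      where
      open ≡-Reasoning
      cancel : ∀ a b → b ≡ a +ℤ - (a +ℤ - b)
      cancel = solve-∀
      expand : ∀ a c d → a +ℤ - (c +ℤ - d) ≡ a +ℤ - c +ℤ d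
      expand = solve-∀

  source-below-diagonal : ∀ v u → v ≤ u → Q u v ≢ + 0 → PiSource F u v
  source-below-diagonal zero u _ Q≢0 =
    source u 0 refl (inj₁ (ℕ.≤-refl , z≤n)) (Q≢0 ∘ trans (bottom-edge u))
  source-below-diagonal (suc v) u v<u Q≢0
    with nonzero-summand _ _ _ (Q≢0 ∘ trans (step-down u v))
  ... | inj₁ F≢0 = source u (suc v) refl (inj₁ (ℕ.≤-refl , v<u)) F≢0
  ... | inj₂ (inj₁ -F≢0) =
    source v (suc u) (trans (ℕ.+-comm v (suc u)) (sym (ℕ.+-suc u v))) (inj₂ (v<u , ℕ.n<1+n v)) (neg≢0 -F≢0)
  ... | inj₂ (inj₂ Q′≢0) with source-below-diagonal v (suc u) (ℕ.m≤n⇒m≤1+n (ℕ.<⇒≤ v<u)) Q′≢0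
  ...   | source p q sum-eq in-range F≢0 =
    source p q (trans sum-eq (sym (ℕ.+-suc u v))) (inPiRange-toward-diagonal (ℕ.<⇒≤ v<u) in-range) F≢0

  source-above-diagonal : ∀ u v → u < v → Q u v ≢ + 0 → PiSource F u v
  source-above-diagonal zero v _ Q≢0 =
    source v 0 (ℕ.+-identityʳ v) (inj₁ (z≤n , ℕ.≤-refl)) (Q≢0 ∘ trans (left-edge v))
  source-above-diagonal (suc u) v 1+u<v Q≢0
    with nonzero-summand _ _ _ (Q≢0 ∘ trans (step-up u v))
  ... | inj₁ Q′≢0 with source-above-diagonal u (suc v) (ℕ.m<n⇒m<1+n (ℕ.<⇒≤ 1+u<v)) Q′≢0
  ...   | source p q sum-eq in-range F≢0 =
    source p q (trans sum-eq (ℕ.+-suc u v))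
      (inPiRange-sym (inPiRange-toward-diagonal (ℕ.<⇒≤ (ℕ.<⇒≤ 1+u<v)) (inPiRange-sym in-range))) F≢0
  source-above-diagonal (suc u) v 1+u<v Q≢0 | inj₂ (inj₁ -F≢0) =
    source u (suc v) (ℕ.+-suc u v) (inj₂ (ℕ.n<1+n u , ℕ.<⇒≤ 1+u<v)) (neg≢0 -F≢0)
  source-above-diagonal (suc u) v 1+u<v Q≢0 | inj₂ (inj₂ F≢0) =
    source v (suc u) (ℕ.+-comm v (suc u)) (inj₁ (ℕ.<⇒≤ 1+u<v , ℕ.≤-refl)) F≢0

  pi-source : ∀ u v → Q u v ≢ + 0 → PiSource F u v
  pi-source u v with ℕ.≤-<-connex v u
  ... | inj₁ v≤u = source-below-diagonal v u v≤u
  ... | inj₂ u<v = source-above-diagonal u v u<v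

unitAt : Fin n → Vec ℕ n
unitAt k = unitVec (suc (toℕ k))

lookup-unitAt-same : (k : Fin n) → lookup (unitAt k) k ≡ 1
lookup-unitAt-same k = trans (Vec.lookup∘tabulate _ k) (cong (λ b → if b then 1 else 0) (≡ᵇ-true {toℕ k} refl))

lookup-unitAt-other : {k p : Fin n} → p ≢ k → lookup (unitAt k) p ≡ 0
lookup-unitAt-other {k = k} {p} p≢k =
  trans (Vec.lookup∘tabulate _ p) (cong (λ b → if b then 1 else 0) (≡ᵇ-false (p≢k ∘ Fin.toℕ-injective)))

unitAt-≤ᵥ : ∀ (k : Fin n) b → 1 ≤ lookup b k → unitAt k ≤ᵥ b
unitAt-≤ᵥ k b 1≤bₖ p with p Fin.≟ k
... | yes refl = subst (_≤ lookup b k) (sym (lookup-unitAt-same k)) 1≤bₖ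
... | no p≢k   = subst (_≤ lookup b p) (sym (lookup-unitAt-other p≢k)) z≤n

unitAt-≰ᵥ : ∀ (k : Fin n) b → lookup b k ≡ 0 → ¬ unitAt k ≤ᵥ b
unitAt-≰ᵥ k b bₖ≡0 eₖ≤b = ℕ.1+n≰n (subst₂ _≤_ (lookup-unitAt-same k) bₖ≡0 (eₖ≤b k))

unitAt-≤ᵥ-unitAt : {k l : Fin n} → unitAt k ≤ᵥ unitAt l → k ≡ l
unitAt-≤ᵥ-unitAt {k = k} {l} eₖ≤eₗ with k Fin.≟ l
... | yes k≡l = k≡l
... | no k≢l  = ⊥-elim (ℕ.1+n≰n (subst₂ _≤_ (lookup-unitAt-same k) (lookup-unitAt-other k≢l) (eₖ≤eₗ k)))

unitAt-≤ᵥ-+ᵥ : {r k l : Fin n} → unitAt r ≤ᵥ unitAt k +ᵥ unitAt l → r ≡ k ⊎ r ≡ l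
unitAt-≤ᵥ-+ᵥ {r = r} {k} {l} eᵣ≤eₖ+eₗ with r Fin.≟ k | r Fin.≟ l
... | yes r≡k | _       = inj₁ r≡k
... | no _    | yes r≡l = inj₂ r≡l
... | no r≢k  | no r≢l  = ⊥-elim (ℕ.1+n≰n (subst₂ _≤_ (lookup-unitAt-same r)
      (trans (lookup-+ᵥ (unitAt k) (unitAt l) r) (cong₂ _+_ (lookup-unitAt-other r≢k) (lookup-unitAt-other r≢l)))
      (eᵣ≤eₖ+eₗ r)))

lookup-∸ᵥ-unitAt-same : ∀ (k : Fin n) b → lookup (b ∸ᵥ unitAt k) k ≡ lookup b k ∸ 1
lookup-∸ᵥ-unitAt-same k b = trans (lookup-∸ᵥ b (unitAt k) k) (cong (lookup b k ∸_) (lookup-unitAt-same k))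

lookup-∸ᵥ-unitAt-other : ∀ {k p : Fin n} b → p ≢ k → lookup (b ∸ᵥ unitAt k) p ≡ lookup b p
lookup-∸ᵥ-unitAt-other {k = k} {p} b p≢k =
  trans (lookup-∸ᵥ b (unitAt k) p) (cong (lookup b p ∸_) (lookup-unitAt-other p≢k))

shift-unitAt-pos : ∀ (G : Mono n → ℤ) k b t → 1 ≤ lookup b k →
  shift G (unitAt k , zeros) (b , t) ≡ G (b ∸ᵥ unitAt k , t)
shift-unitAt-pos G k b t 1≤bₖ with (unitAt k , zeros) ≤ₘ? (b , t)
... | yes _ = cong (λ t′ → G (b ∸ᵥ unitAt k , t′)) (m∸ᵥ0≡m t)
... | no ≰ = ⊥-elim (≰ (unitAt-≤ᵥ k b 1≤bₖ , 0≤ᵥm t))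

shift-unitAt-zero : ∀ (G : Mono n → ℤ) k b t → lookup b k ≡ 0 → shift G (unitAt k , zeros) (b , t) ≡ + 0
shift-unitAt-zero G k b t bₖ≡0 with (unitAt k , zeros) ≤ₘ? (b , t)
... | yes (eₖ≤b , _) = ⊥-elim (unitAt-≰ᵥ k b bₖ≡0 eₖ≤b)
... | no _ = refl

at-suc-toℕ : ∀ (a : Vec ℕ n) p → at a (suc (toℕ p)) ≡ lookup a p
at-suc-toℕ (x ∷ᵥ a) fzero    = refl
at-suc-toℕ (x ∷ᵥ a) (fsuc p) = at-suc-toℕ a p

-- ι and ι′ are the (0-based) positions of x_i and x_{i+1}, where i = suc j.
module Adjacent {n} (j : ℕ) (1+j<n : suc j < n) where

  ι ι′ : Fin n
  ι  = fromℕ< (ℕ.<-trans (ℕ.n<1+n j) 1+j<n)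
  ι′ = fromℕ< 1+j<n

  toℕ-ι : toℕ ι ≡ j
  toℕ-ι = Fin.toℕ-fromℕ< _

  toℕ-ι′ : toℕ ι′ ≡ suc j
  toℕ-ι′ = Fin.toℕ-fromℕ< 1+j<n

  ι≢ι′ : ι ≢ ι′
  ι≢ι′ ι≡ι′ = ℕ.1+n≢n (sym (trans (sym toℕ-ι) (trans (cong toℕ ι≡ι′) toℕ-ι′)))

  position : ∀ p → p ≡ ι ⊎ p ≡ ι′ ⊎ (p ≢ ι × p ≢ ι′)
  position p with p Fin.≟ ι | p Fin.≟ ι′
  ... | yes p≡ι | _        = inj₁ p≡ι
  ... | no _    | yes p≡ι′ = inj₂ (inj₁ p≡ι′)
  ... | no p≢ι  | no p≢ι′  = inj₂ (inj₂ (p≢ι , p≢ι′))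

  ≡-by-position : {x y : Vec ℕ n} → lookup x ι ≡ lookup y ι → lookup x ι′ ≡ lookup y ι′ →
    (∀ p → p ≢ ι → p ≢ ι′ → lookup x p ≡ lookup y p) → x ≡ y
  ≡-by-position x≡yᵢ x≡yᵢ′ x≡yₒ = lookup-ext λ p → case p (position p)
    where
    case : ∀ p → p ≡ ι ⊎ p ≡ ι′ ⊎ (p ≢ ι × p ≢ ι′) → _
    case p (inj₁ refl)                   = x≡yᵢ
    case p (inj₂ (inj₁ refl))            = x≡yᵢ′
    case p (inj₂ (inj₂ (p≢ι , p≢ι′))) = x≡yₒ p p≢ι p≢ι′

  set : Vec ℕ n → ℕ → ℕ → Vec ℕ n
  set a u v = a [ ι ]≔ u [ ι′ ]≔ v

  lookup-set-ι : ∀ a u v → lookup (set a u v) ι ≡ u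
  lookup-set-ι a u v = trans (Vec.lookup∘update′ ι≢ι′ (a [ ι ]≔ u) v) (Vec.lookup∘update ι a u)

  lookup-set-ι′ : ∀ a u v → lookup (set a u v) ι′ ≡ v
  lookup-set-ι′ a u v = Vec.lookup∘update ι′ (a [ ι ]≔ u) v

  lookup-set-other : ∀ a u v {p} → p ≢ ι → p ≢ ι′ → lookup (set a u v) p ≡ lookup a p
  lookup-set-other a u v p≢ι p≢ι′ =
    trans (Vec.lookup∘update′ p≢ι′ (a [ ι ]≔ u) v) (Vec.lookup∘update′ p≢ι a u)

  set-lookup : ∀ a → set a (lookup a ι) (lookup a ι′) ≡ a
  set-lookup a = trans (cong (_[ ι′ ]≔ lookup a ι′) (Vec.[]≔-lookup a ι)) (Vec.[]≔-lookup a ι′)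

  set-∸ᵥ-ι : ∀ a u v → set a (suc u) v ∸ᵥ unitAt ι ≡ set a u v
  set-∸ᵥ-ι a u v = ≡-by-position
    (trans (lookup-∸ᵥ-unitAt-same ι (set a (suc u) v))
           (trans (cong (_∸ 1) (lookup-set-ι a (suc u) v)) (sym (lookup-set-ι a u v))))
    (trans (lookup-∸ᵥ-unitAt-other (set a (suc u) v) (ι≢ι′ ∘ sym))
           (trans (lookup-set-ι′ a (suc u) v) (sym (lookup-set-ι′ a u v))))
    (λ p p≢ι p≢ι′ → trans (lookup-∸ᵥ-unitAt-other (set a (suc u) v) p≢ι)
                      (trans (lookup-set-other a (suc u) v p≢ι p≢ι′) (sym (lookup-set-other a u v p≢ι p≢ι′))))

  set-∸ᵥ-ι′ : ∀ a u v → set a u (suc v) ∸ᵥ unitAt ι′ ≡ set a u v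
  set-∸ᵥ-ι′ a u v = ≡-by-position
    (trans (lookup-∸ᵥ-unitAt-other (set a u (suc v)) ι≢ι′)
           (trans (lookup-set-ι a u (suc v)) (sym (lookup-set-ι a u v))))
    (trans (lookup-∸ᵥ-unitAt-same ι′ (set a u (suc v)))
           (trans (cong (_∸ 1) (lookup-set-ι′ a u (suc v))) (sym (lookup-set-ι′ a u v))))
    (λ p p≢ι p≢ι′ → trans (lookup-∸ᵥ-unitAt-other (set a u (suc v)) p≢ι′)
                      (trans (lookup-set-other a u (suc v) p≢ι p≢ι′) (sym (lookup-set-other a u v p≢ι p≢ι′))))

  shift-ι-suc : ∀ (G : Mono n → ℤ) a u v t →
    shift G (unitAt ι , zeros) (set a (suc u) v , t) ≡ G (set a u v , t)
  shift-ι-suc G a u v t =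
    trans (shift-unitAt-pos G ι _ t (subst (1 ≤_) (sym (lookup-set-ι a (suc u) v)) (s≤s z≤n)))
          (cong (λ b → G (b , t)) (set-∸ᵥ-ι a u v))

  shift-ι′-suc : ∀ (G : Mono n → ℤ) a u v t →
    shift G (unitAt ι′ , zeros) (set a u (suc v) , t) ≡ G (set a u v , t)
  shift-ι′-suc G a u v t =
    trans (shift-unitAt-pos G ι′ _ t (subst (1 ≤_) (sym (lookup-set-ι′ a u (suc v))) (s≤s z≤n)))
          (cong (λ b → G (b , t)) (set-∸ᵥ-ι′ a u v))

  shift-ι-zero : ∀ (G : Mono n → ℤ) a v t → shift G (unitAt ι , zeros) (set a 0 v , t) ≡ + 0
  shift-ι-zero G a v t = shift-unitAt-zero G ι _ t (lookup-set-ι a 0 v)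

  shift-ι′-zero : ∀ (G : Mono n → ℤ) a u t → shift G (unitAt ι′ , zeros) (set a u 0 , t) ≡ + 0
  shift-ι′-zero G a u t = shift-unitAt-zero G ι′ _ t (lookup-set-ι′ a u 0)

  swapℕ-ι : swapℕ (suc j) (suc (toℕ ι)) ≡ suc (toℕ ι′)
  swapℕ-ι rewrite toℕ-ι | toℕ-ι′ | ≡ᵇ-true {j} refl = refl

  swapℕ-ι′ : swapℕ (suc j) (suc (toℕ ι′)) ≡ suc (toℕ ι)
  swapℕ-ι′ rewrite toℕ-ι | toℕ-ι′ | ≡ᵇ-false (ℕ.1+n≢n {j}) | ≡ᵇ-true {j} refl = refl

  swapℕ-other : ∀ {p} → p ≢ ι → p ≢ ι′ → swapℕ (suc j) (suc (toℕ p)) ≡ suc (toℕ p)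
  swapℕ-other {p} p≢ι p≢ι′
    rewrite ≡ᵇ-false (p≢ι ∘ Fin.toℕ-injective ∘ flip trans (sym toℕ-ι))
          | ≡ᵇ-false (p≢ι′ ∘ Fin.toℕ-injective ∘ flip trans (sym toℕ-ι′)) = refl

  swapExp : Vec ℕ n → Vec ℕ n
  swapExp a = tabulate (λ p → at a (swapℕ (suc j) (suc (toℕ p))))

  lookup-swapExp : ∀ a p → lookup (swapExp a) p ≡ at a (swapℕ (suc j) (suc (toℕ p)))
  lookup-swapExp a p = Vec.lookup∘tabulate _ p

  lookup-swapExp-ι : ∀ a → lookup (swapExp a) ι ≡ lookup a ι′
  lookup-swapExp-ι a = trans (lookup-swapExp a ι) (trans (cong (at a) swapℕ-ι) (at-suc-toℕ a ι′))

  lookup-swapExp-ι′ : ∀ a → lookup (swapExp a) ι′ ≡ lookup a ι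
  lookup-swapExp-ι′ a = trans (lookup-swapExp a ι′) (trans (cong (at a) swapℕ-ι′) (at-suc-toℕ a ι))

  lookup-swapExp-other : ∀ a {p} → p ≢ ι → p ≢ ι′ → lookup (swapExp a) p ≡ lookup a p
  lookup-swapExp-other a {p} p≢ι p≢ι′ =
    trans (lookup-swapExp a p) (trans (cong (at a) (swapℕ-other p≢ι p≢ι′)) (at-suc-toℕ a p))

  swapExp-set : ∀ a u v → swapExp (set a u v) ≡ set a v u
  swapExp-set a u v = ≡-by-position
    (trans (lookup-swapExp-ι (set a u v)) (trans (lookup-set-ι′ a u v) (sym (lookup-set-ι a v u))))
    (trans (lookup-swapExp-ι′ (set a u v)) (trans (lookup-set-ι a u v) (sym (lookup-set-ι′ a v u))))
    (λ p p≢ι p≢ι′ → trans (lookup-swapExp-other (set a u v) p≢ι p≢ι′)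
                      (trans (lookup-set-other a u v p≢ι p≢ι′) (sym (lookup-set-other a v u p≢ι p≢ι′))))

  swapExp-involutive : ∀ a → swapExp (swapExp a) ≡ a
  swapExp-involutive a = ≡-by-position
    (trans (lookup-swapExp-ι (swapExp a)) (lookup-swapExp-ι′ a))
    (trans (lookup-swapExp-ι′ (swapExp a)) (lookup-swapExp-ι a))
    (λ p p≢ι p≢ι′ → trans (lookup-swapExp-other (swapExp a) p≢ι p≢ι′)
                           (lookup-swapExp-other a p≢ι p≢ι′))

  monoEq-swapExp : ∀ a u b t → monoEq (swapExp a , u) (b , t) ≡ monoEq (a , u) (swapExp b , t)
  monoEq-swapExp a u b t with (a , u) ≟ₘ (swapExp b , t)
  ... | yes refl = trans (monoEq-≡ (cong (_, t) (swapExp-involutive b))) (sym (monoEq-≡ {m = a , u} refl))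
  ... | no ≢ = trans (monoEq-≢ (≢ ∘ swapped)) (sym (monoEq-≢ ≢))
    where
    swapped : (swapExp a , u) ≡ (b , t) → (a , u) ≡ (swapExp b , t)
    swapped refl = cong (_, u) (sym (swapExp-involutive a))

  coeff-sPoly : ∀ (F : Poly n) b t → coeff (sPoly (suc j) F) (b , t) ≡ coeff F (swapExp b , t)
  coeff-sPoly [] b t = refl
  coeff-sPoly ((c , (a , u)) ∷ F) b t =
    cong₂ (λ e x → (if e then c else + 0) +ℤ x) (monoEq-swapExp a u b t) (coeff-sPoly F b t)

  set≡zeros⇒≡zeros : ∀ a p q → p + q ≡ lookup a ι + lookup a ι′ → set a p q ≡ zeros → a ≡ zeros
  set≡zeros⇒≡zeros a p q sum-eq set≡0 = ≡-by-position
    (trans (ℕ.m+n≡0⇒m≡0 _ u+v≡0) (sym (lookup-zeros ι)))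
    (trans (ℕ.m+n≡0⇒n≡0 _ u+v≡0) (sym (lookup-zeros ι′)))
    (λ r r≢ι r≢ι′ → trans (sym (lookup-set-other a p q r≢ι r≢ι′)) (set≡0ᵣ r))
    where
    set≡0ᵣ : ∀ r → lookup (set a p q) r ≡ lookup zeros r
    set≡0ᵣ r = cong (λ b → lookup b r) set≡0
    u+v≡0 : lookup a ι + lookup a ι′ ≡ 0
    u+v≡0 = trans (sym sum-eq) (cong₂ _+_
      (trans (sym (lookup-set-ι a p q)) (trans (set≡0ᵣ ι) (lookup-zeros ι)))
      (trans (sym (lookup-set-ι′ a p q)) (trans (set≡0ᵣ ι′) (lookup-zeros ι′))))

  sum-map-set : ∀ f a p q →
    sum (mapᵥ f (set a p q)) + (f (lookup a ι) + f (lookup a ι′)) ≡ sum (mapᵥ f a) + (f p + f q)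
  sum-map-set f a p q = begin
    Σ (set a p q) + (f (lookup a ι) + f (lookup a ι′))
      ≡⟨ cong (λ x → Σ (set a p q) + (f (lookup a ι) + f x)) (Vec.lookup∘update′ (ι≢ι′ ∘ sym) a p) ⟨
    Σ (set a p q) + (f (lookup a ι) + f (lookup (a [ ι ]≔ p) ι′))
      ≡⟨ ℕ+.x∙yz≈xz∙y (Σ (set a p q)) (f (lookup a ι)) (f (lookup (a [ ι ]≔ p) ι′)) ⟩
    Σ (set a p q) + f (lookup (a [ ι ]≔ p) ι′) + f (lookup a ι)
      ≡⟨ cong (_+ f (lookup a ι)) (sum-map-[]≔ f (a [ ι ]≔ p) ι′ q) ⟩
    Σ (a [ ι ]≔ p) + f q + f (lookup a ι)
      ≡⟨ ℕ+.xy∙z≈xz∙y (Σ (a [ ι ]≔ p)) (f q) (f (lookup a ι)) ⟩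
    Σ (a [ ι ]≔ p) + f (lookup a ι) + f q
      ≡⟨ cong (_+ f q) (sum-map-[]≔ f a ι p) ⟩
    Σ a + f p + f q
      ≡⟨ ℕ.+-assoc (Σ a) (f p) (f q) ⟩
    Σ a + (f p + f q) ∎
    where
    open ≡-Reasoning
    Σ : Vec ℕ n → ℕ
    Σ b = sum (mapᵥ f b)

  module PiStep (F Q : Poly n) (isPi : IsPi (suc j) F Q) where

    private
      S : Poly n
      S = sPoly (suc j) F

      eᵢ≡ : unitVec (suc j) ≡ unitAt ι
      eᵢ≡ = cong (unitVec ∘ suc) (sym toℕ-ι)

      eᵢ₊₁≡ : unitVec (suc (suc j)) ≡ unitAt ι′
      eᵢ₊₁≡ = cong (unitVec ∘ suc) (sym toℕ-ι′)

    Δ : (Mono n → ℤ) → (Mono n → ℤ) → Mono n → ℤ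
    Δ G H m = shift G (unitAt ι , zeros) m +ℤ - shift H (unitAt ι′ , zeros) m

    pi-coeff : ∀ m → Δ (coeff Q) (coeff Q) m ≡ Δ (coeff F) (coeff S) m
    pi-coeff m = subst₂ (λ e e′ → shift (coeff Q) (e , zeros) m +ℤ - shift (coeff Q) (e′ , zeros) m
                                ≡ shift (coeff F) (e , zeros) m +ℤ - shift (coeff S) (e′ , zeros) m)
                        eᵢ≡ eᵢ₊₁≡ (begin
      shift (coeff Q) (eᵢ , zeros) m +ℤ - shift (coeff Q) (eᵢ₊₁ , zeros) m
        ≡⟨ coeff-binomial-⊗ eᵢ eᵢ₊₁ Q m ⟨
      coeff ((xVar (suc j) ⊕ neg (xVar (suc (suc j)))) ⊗ Q) m
        ≡⟨ isPi m ⟩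
      coeff ((xVar (suc j) ⊗ F) ⊕ neg (xVar (suc (suc j)) ⊗ S)) m
        ≡⟨ coeff-++ (xVar (suc j) ⊗ F) (neg (xVar (suc (suc j)) ⊗ S)) m ⟩
      coeff (xVar (suc j) ⊗ F) m +ℤ coeff (neg (xVar (suc (suc j)) ⊗ S)) m
        ≡⟨ cong₂ _+ℤ_ (coeff-single-⊗ (+ 1) eᵢ zeros F m)
                      (trans (coeff-neg (xVar (suc (suc j)) ⊗ S) m) (cong -_ (coeff-single-⊗ (+ 1) eᵢ₊₁ zeros S m))) ⟩
      + 1 *ℤ shift (coeff F) (eᵢ , zeros) m +ℤ - (+ 1 *ℤ shift (coeff S) (eᵢ₊₁ , zeros) m)
        ≡⟨ cong₂ (λ x y → x +ℤ - y) (ℤ.*-identityˡ (shift (coeff F) (eᵢ , zeros) m))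
                                    (ℤ.*-identityˡ (shift (coeff S) (eᵢ₊₁ , zeros) m)) ⟩
      shift (coeff F) (eᵢ , zeros) m +ℤ - shift (coeff S) (eᵢ₊₁ , zeros) m ∎)
      where
      open ≡-Reasoning
      eᵢ eᵢ₊₁ : Vec ℕ n
      eᵢ = unitVec (suc j)
      eᵢ₊₁ = unitVec (suc (suc j))

    module Line (a t : Vec ℕ n) where

      Qline Fline : ℕ → ℕ → ℤ
      Qline u v = coeff Q (set a u v , t)
      Fline u v = coeff F (set a u v , t)

      private
        S-swaps : ∀ u v → coeff S (set a u v , t) ≡ Fline v u
        S-swaps u v = trans (coeff-sPoly F (set a u v) t) (cong (λ b → coeff F (b , t)) (swapExp-set a u v))

      bottom-edge : ∀ u → Qline u 0 ≡ Fline u 0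
      bottom-edge u = begin
        Qline u 0                 ≡⟨ ℤ.+-identityʳ _ ⟨
        Qline u 0 +ℤ - + 0
          ≡⟨ cong₂ (λ x y → x +ℤ - y) (shift-ι-suc (coeff Q) a u 0 t) (shift-ι′-zero (coeff Q) a (suc u) t) ⟨
        Δ (coeff Q) (coeff Q) m
          ≡⟨ pi-coeff m ⟩
        Δ (coeff F) (coeff S) m
          ≡⟨ cong₂ (λ x y → x +ℤ - y) (shift-ι-suc (coeff F) a u 0 t) (shift-ι′-zero (coeff S) a (suc u) t) ⟩
        Fline u 0 +ℤ - + 0        ≡⟨ ℤ.+-identityʳ _ ⟩
        Fline u 0                 ∎
        where
        open ≡-Reasoning
        m : Mono n
        m = set a (suc u) 0 , t

      left-edge : ∀ v → Qline 0 v ≡ Fline v 0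
      left-edge v = ℤ.neg-injective (begin
        - Qline 0 v               ≡⟨ ℤ.+-identityˡ _ ⟨
        + 0 +ℤ - Qline 0 v
          ≡⟨ cong₂ (λ x y → x +ℤ - y) (shift-ι-zero (coeff Q) a (suc v) t) (shift-ι′-suc (coeff Q) a 0 v t) ⟨
        Δ (coeff Q) (coeff Q) m
          ≡⟨ pi-coeff m ⟩
        Δ (coeff F) (coeff S) m
          ≡⟨ cong₂ (λ x y → x +ℤ - y) (shift-ι-zero (coeff F) a (suc v) t)
                                      (trans (shift-ι′-suc (coeff S) a 0 v t) (S-swaps 0 v)) ⟩
        + 0 +ℤ - Fline v 0        ≡⟨ ℤ.+-identityˡ _ ⟩
        - Fline v 0               ∎)
        where
        open ≡-Reasoning
        m : Mono n
        m = set a 0 (suc v) , t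

      interior : ∀ u v → Qline u (suc v) +ℤ - Qline (suc u) v ≡ Fline u (suc v) +ℤ - Fline v (suc u)
      interior u v = begin
        Qline u (suc v) +ℤ - Qline (suc u) v
          ≡⟨ cong₂ (λ x y → x +ℤ - y) (shift-ι-suc (coeff Q) a u (suc v) t)
                                      (shift-ι′-suc (coeff Q) a (suc u) v t) ⟨
        Δ (coeff Q) (coeff Q) m
          ≡⟨ pi-coeff m ⟩
        Δ (coeff F) (coeff S) m
          ≡⟨ cong₂ (λ x y → x +ℤ - y) (shift-ι-suc (coeff F) a u (suc v) t)
                                      (trans (shift-ι′-suc (coeff S) a (suc u) v t) (S-swaps (suc u) v)) ⟩
        Fline u (suc v) +ℤ - Fline v (suc u) ∎
        where
        open ≡-Reasoning
        m : Mono n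
        m = set a (suc u) (suc v) , t

      open DividedDifference Qline Fline bottom-edge left-edge interior public using (pi-source)

    coeff-source : ∀ a t → coeff Q (a , t) ≢ + 0 →
      PiSource (λ u v → coeff F (set a u v , t)) (lookup a ι) (lookup a ι′)
    coeff-source a t Q≢0 =
      Line.pi-source a t (lookup a ι) (lookup a ι′) (Q≢0 ∘ trans (cong (λ b → coeff Q (b , t)) (sym (set-lookup a))))

    coeff-constant : ∀ t → coeff Q (zeros , t) ≡ coeff F (zeros , t)
    coeff-constant t = subst (λ b → coeff Q (b , t) ≡ coeff F (b , t)) set-zeros (Line.bottom-edge zeros t 0)
      where
      set-zeros : set zeros 0 0 ≡ zeros
      set-zeros = trans (cong₂ (set zeros) (sym (lookup-zeros ι)) (sym (lookup-zeros ι′))) (set-lookup zeros)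

Binary : Vec ℕ n → Set
Binary a = ∀ p → lookup a p ≤ 1

record QuadraticShape (k l : Fin n) (a : Vec ℕ n) : Set where
  constructor quadraticShape
  field
    entries≤2 : ∀ p → lookup a p ≤ 2
    twos≤     : countVal 2 a ≤ suc (toℕ k)
    degree    : sum a ≡ suc (toℕ k) + suc (toℕ l)

twos≤sum : ∀ (x y : Vec ℕ n) → Binary x → Binary y → countVal 2 (x +ᵥ y) ≤ sum x
twos≤sum []ᵥ       []ᵥ       _  _  = z≤n
twos≤sum (x ∷ᵥ xs) (y ∷ᵥ ys) bx by =
  ℕ.+-mono-≤ (two≤ x y (bx fzero) (by fzero)) (twos≤sum xs ys (bx ∘ fsuc) (by ∘ fsuc))
  where
  two≤ : ∀ x y → x ≤ 1 → y ≤ 1 → indicator 2 (x + y) ≤ x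
  two≤ zero          zero          _ _ = z≤n
  two≤ zero          (suc zero)    _ _ = z≤n
  two≤ (suc zero)    zero          _ _ = z≤n
  two≤ (suc zero)    (suc zero)    _ _ = ℕ.≤-refl
  two≤ (suc (suc _)) _             (s≤s ()) _
  two≤ _             (suc (suc _)) _ (s≤s ())

binary-+ᵥ-shape : ∀ {k l : Fin n} {x y} → Binary x → Binary y → sum x ≡ suc (toℕ k) → sum y ≡ suc (toℕ l) →
  QuadraticShape k l (x +ᵥ y)
binary-+ᵥ-shape {x = x} {y} bx by Σx Σy = quadraticShape
  (λ p → subst (_≤ 2) (sym (lookup-+ᵥ x y p)) (ℕ.+-mono-≤ (bx p) (by p)))
  (subst (countVal 2 (x +ᵥ y) ≤_) Σx (twos≤sum x y bx by))
  (trans (sum-+ᵥ x y) (cong₂ _+_ Σx Σy))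

-- G, viewed as a power series in the T's, is 1 + (terms x^a T_k with a of the given linear shape)
-- + (terms x^a T_k T_l of quadratic shape) + O(T³).
record LowOrderShape (Linear : Fin n → Vec ℕ n → Set) (G : Mono n → ℤ) : Set where
  field
    constant  : G zerosₘ ≡ + 1
    pure-x    : ∀ a → a ≢ zeros → G (a , zeros) ≡ + 0
    linear    : ∀ a k → G (a , unitAt k) ≢ + 0 → Linear k a
    quadratic : ∀ a (k l : Fin n) → toℕ k ≤ toℕ l → G (a , unitAt k +ᵥ unitAt l) ≢ + 0 → QuadraticShape k l a

NoLinear : Fin n → Vec ℕ n → Set
NoLinear _ _ = ⊥

lowOrderShape-cong : ∀ {L : Fin n → Vec ℕ n → Set} {G G′} → (∀ m → G m ≡ G′ m) →
  LowOrderShape L G → LowOrderShape L G′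
lowOrderShape-cong G≗G′ shape = record
  { constant  = trans (sym (G≗G′ _)) constant
  ; pure-x    = λ a a≢0 → trans (sym (G≗G′ _)) (pure-x a a≢0)
  ; linear    = λ a k G′≢0 → linear a k (G′≢0 ∘ trans (sym (G≗G′ _)))
  ; quadratic = λ a k l k≤l G′≢0 → quadratic a k l k≤l (G′≢0 ∘ trans (sym (G≗G′ _)))
  }
  where open LowOrderShape shape

lowOrderShape-noLinear : ∀ {L : Fin n → Vec ℕ n → Set} {G} → LowOrderShape NoLinear G → LowOrderShape L G
lowOrderShape-noLinear shape = record
  { constant = constant ; pure-x = pure-x ; linear = λ a k G≢0 → ⊥-elim (linear a k G≢0) ; quadratic = quadratic }
  where open LowOrderShape shape

coeff-one : LowOrderShape NoLinear (coeff {n} one)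
coeff-one {n} = record
  { constant  = cong (λ b → (if b then + 1 else + 0) +ℤ + 0) (monoEq-≡ {m = zerosₘ {n}} refl)
  ; pure-x    = λ a a≢0 → vanishes (a≢0 ∘ sym ∘ cong proj₁)
  ; linear    = λ a k one≢0 → one≢0 (vanishes-T (unitAt k) k unitAtₖ≢0)
  ; quadratic = λ a k l _ one≢0 → ⊥-elim (one≢0 (vanishes-T (unitAt k +ᵥ unitAt l) k
                  (unitAtₖ≢0 ∘ ℕ.m+n≡0⇒m≡0 _ ∘ trans (sym (lookup-+ᵥ (unitAt k) (unitAt l) k)))))
  }
  where
  vanishes : ∀ {m} → zerosₘ ≢ m → coeff one m ≡ + 0
  vanishes {m} 0≢m = cong (λ b → (if b then + 1 else + 0) +ℤ + 0) (monoEq-≢ {m = zerosₘ} {m} 0≢m)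
  vanishes-T : ∀ {a} t k → lookup t k ≢ 0 → coeff one (a , t) ≡ + 0
  vanishes-T t k tₖ≢0 =
    vanishes λ 0≡m → tₖ≢0 (trans (cong (λ m → lookup (proj₂ m) k) (sym 0≡m)) (lookup-zeros k))
  unitAtₖ≢0 : ∀ {k : Fin n} → lookup (unitAt k) k ≢ 0
  unitAtₖ≢0 {k} = ℕ.1+n≢0 ∘ trans (sym (lookup-unitAt-same k))

module Steps {n} (j : ℕ) (1+j<n : suc j < n) where
  open Adjacent j 1+j<n

  -- The shape of the linear term x^{s_i α} T_l of a factor of N_{w,i}.
  record LinearShape (k : Fin n) (a : Vec ℕ n) : Set where
    constructor linearShape
    field
      binary : Binary a
      degree : sum a ≡ suc (toℕ k)
      at-ι   : lookup a ι ≡ 0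
      at-ι′  : lookup a ι′ ≡ 1

  factor-step : ∀ {G β r} → LowOrderShape LinearShape G → LinearShape r β →
    LowOrderShape LinearShape (λ m → G m +ℤ - shift G (β , unitAt r) m)
  factor-step {G} {β} {r} shape β-shape = record
    { constant  = trans (cong (λ x → G zerosₘ +ℤ - x) (shift-pure-x zeros)) (trans (ℤ.+-identityʳ _) constant)
    ; pure-x    = λ a a≢0 →
        trans (cong (λ x → G (a , zeros) +ℤ - x) (shift-pure-x a)) (trans (ℤ.+-identityʳ _) (pure-x a a≢0))
    ; linear    = linear′
    ; quadratic = quadratic′
    }
    where
    open LowOrderShape shape
    open LinearShape β-shape using (binary; degree)

    shift-pure-x : ∀ a → shift G (β , unitAt r) (a , zeros) ≡ + 0
    shift-pure-x a with (β , unitAt r) ≤ₘ? (a , zeros)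
    ... | yes (_ , eᵣ≤0) = ⊥-elim (unitAt-≰ᵥ r zeros (lookup-zeros r) eᵣ≤0)
    ... | no _ = refl

    linear′ : ∀ a k → G (a , unitAt k) +ℤ - shift G (β , unitAt r) (a , unitAt k) ≢ + 0 → LinearShape k a
    linear′ a k G′≢0 with nonzero-difference _ _ G′≢0
    ... | inj₁ G≢0 = linear a k G≢0
    ... | inj₂ shift≢0 with shift-nonzero G _ _ shift≢0
    ...   | (β≤a , eᵣ≤eₖ) , G≢0 with unitAt-≤ᵥ-unitAt eᵣ≤eₖ
    ...     | refl = subst (LinearShape r) (sym (m∸ᵥn≡0⇒m≡n β≤a a∸β≡0)) β-shape
      where
      a∸β≡0 : a ∸ᵥ β ≡ zeros
      a∸β≡0 = decidable-stable (≡ᵥ-dec ℕ._≟_ _ _) λ a∸β≢0 →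
        G≢0 (trans (cong (λ t → G (a ∸ᵥ β , t)) (m∸ᵥm≡0 (unitAt r))) (pure-x _ a∸β≢0))

    quadratic′ : ∀ a k l → toℕ k ≤ toℕ l →
      G (a , unitAt k +ᵥ unitAt l) +ℤ - shift G (β , unitAt r) (a , unitAt k +ᵥ unitAt l) ≢ + 0 → QuadraticShape k l a
    quadratic′ a k l k≤l G′≢0 with nonzero-difference _ _ G′≢0
    ... | inj₁ G≢0 = quadratic a k l k≤l G≢0
    ... | inj₂ shift≢0 with shift-nonzero G _ _ shift≢0
    ...   | (β≤a , eᵣ≤eₖ+eₗ) , G≢0 with unitAt-≤ᵥ-+ᵥ eᵣ≤eₖ+eₗ
    ...     | inj₁ refl = subst (QuadraticShape k l) (trans (+ᵥ-comm β _) a∸β+β≡a)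
                            (binary-+ᵥ-shape binary (LinearShape.binary rest) degree (LinearShape.degree rest))
      where
      rest : LinearShape l (a ∸ᵥ β)
      rest = linear _ l (G≢0 ∘ trans (cong (λ t → G (a ∸ᵥ β , t)) (m+ᵥn∸ᵥm≡n (unitAt r) (unitAt l))))
      a∸β+β≡a : a ∸ᵥ β +ᵥ β ≡ a
      a∸β+β≡a = m∸ᵥn+ᵥn≡m β≤a
    ...     | inj₂ refl = subst (QuadraticShape k l) (m∸ᵥn+ᵥn≡m β≤a)
                            (binary-+ᵥ-shape (LinearShape.binary rest) binary (LinearShape.degree rest) degree)
      where
      rest : LinearShape k (a ∸ᵥ β)
      rest = linear _ k (G≢0 ∘ trans (cong (λ t → G (a ∸ᵥ β , t)) (m+ᵥn∸ᵥn≡m (unitAt k) (unitAt r))))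

  quadraticShape-transfer : ∀ {k l : Fin n} a p q →
    p + q ≡ lookup a ι + lookup a ι′ → InPiRange p (lookup a ι) (lookup a ι′) →
    QuadraticShape k l (set a p q) → QuadraticShape k l a
  quadraticShape-transfer {k} {l} a p q sum-eq in-range (quadraticShape entries≤2 twos≤ degree) =
    quadraticShape entries≤2′ twos≤′ degree′
    where
    u v : ℕ
    u = lookup a ι
    v = lookup a ι′
    I : ℕ → ℕ
    I = indicator 2
    p≤2 : p ≤ 2
    p≤2 = subst (_≤ 2) (lookup-set-ι a p q) (entries≤2 ι)
    q≤2 : q ≤ 2
    q≤2 = subst (_≤ 2) (lookup-set-ι′ a p q) (entries≤2 ι′)
    bounds : u ≤ 2 × v ≤ 2 × I u + I v ≤ I p + I q
    bounds = inPiRange-twos p≤2 q≤2 sum-eq in-range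

    entries≤2′ : ∀ r → lookup a r ≤ 2
    entries≤2′ r with position r
    ... | inj₁ refl                   = proj₁ bounds
    ... | inj₂ (inj₁ refl)            = proj₁ (proj₂ bounds)
    ... | inj₂ (inj₂ (r≢ι , r≢ι′)) = subst (_≤ 2) (lookup-set-other a p q r≢ι r≢ι′) (entries≤2 r)

    twos≤′ : countVal 2 a ≤ suc (toℕ k)
    twos≤′ = begin
      countVal 2 a                 ≡⟨ countVal-sum 2 a ⟩
      sum (mapᵥ I a)               ≤⟨ ℕ.+-cancelʳ-≤ (I p + I q) _ _ (begin
        sum (mapᵥ I a) + (I p + I q)         ≡⟨ sum-map-set I a p q ⟨
        sum (mapᵥ I (set a p q)) + (I u + I v)
          ≤⟨ ℕ.+-monoʳ-≤ (sum (mapᵥ I (set a p q))) (proj₂ (proj₂ bounds)) ⟩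
        sum (mapᵥ I (set a p q)) + (I p + I q) ∎) ⟩
      sum (mapᵥ I (set a p q))     ≡⟨ countVal-sum 2 (set a p q) ⟨
      countVal 2 (set a p q)       ≤⟨ twos≤ ⟩
      suc (toℕ k)                  ∎
      where open ℕ.≤-Reasoning

    degree′ : sum a ≡ suc (toℕ k) + suc (toℕ l)
    degree′ = trans (ℕ.+-cancelʳ-≡ (u + v) (sum a) (sum (set a p q)) (begin
      sum a + (u + v)                     ≡⟨ cong₂ _+_ (cong sum (Vec.map-id a)) sum-eq ⟨
      sum (mapᵥ id a) + (p + q)           ≡⟨ sum-map-set id a p q ⟨
      sum (mapᵥ id (set a p q)) + (u + v) ≡⟨ cong (_+ (u + v)) (cong sum (Vec.map-id (set a p q))) ⟩
      sum (set a p q) + (u + v)           ∎)) degree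
      where open ≡-Reasoning

  pi-step : ∀ {F Q} → IsPi (suc j) F Q → LowOrderShape LinearShape (coeff F) → LowOrderShape NoLinear (coeff Q)
  pi-step {F} {Q} isPi shape = record
    { constant  = trans (coeff-constant zeros) constant
    ; pure-x    = λ a a≢0 → ≡0-stable (pure-x′ a a≢0)
    ; linear    = linear′
    ; quadratic = quadratic′
    }
    where
    open PiStep F Q isPi
    open LowOrderShape shape

    pure-x′ : ∀ a → a ≢ zeros → ¬ coeff Q (a , zeros) ≢ + 0
    pure-x′ a a≢0 Q≢0 =
      a≢0 (set≡zeros⇒≡zeros a p q sum-eq (decidable-stable (≡ᵥ-dec ℕ._≟_ _ _) (nonzero ∘ pure-x _)))
      where open PiSource (coeff-source a zeros Q≢0)

    linear′ : ∀ a k → coeff Q (a , unitAt k) ≢ + 0 → ⊥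
    linear′ a k Q≢0 = inPiRange-0-1 p≡0 q≡1 sum-eq in-range
      where
      open PiSource (coeff-source a (unitAt k) Q≢0)
      open LinearShape (linear _ k nonzero)
      p≡0 : p ≡ 0
      p≡0 = trans (sym (lookup-set-ι a p q)) at-ι
      q≡1 : q ≡ 1
      q≡1 = trans (sym (lookup-set-ι′ a p q)) at-ι′

    quadratic′ : ∀ a k l → toℕ k ≤ toℕ l → coeff Q (a , unitAt k +ᵥ unitAt l) ≢ + 0 → QuadraticShape k l a
    quadratic′ a k l k≤l Q≢0 = quadraticShape-transfer a p q sum-eq in-range (quadratic _ k l k≤l nonzero)
      where open PiSource (coeff-source a (unitAt k +ᵥ unitAt l) Q≢0)

module _ where
  open ListAll using ([]; _∷_)
  open ListAllPairs using ([]; _∷_)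

  Sorted : List ℕ → Set
  Sorted = AllPairs _≤_

  indicator-refl : ∀ x → indicator x x ≡ 1
  indicator-refl x = cong (λ b → if b then 1 else 0) (≡ᵇ-true {x} refl)

  indicator-≢ : ∀ {x a} → x ≢ a → indicator x a ≡ 0
  indicator-≢ x≢a = cong (λ b → if b then 1 else 0) (≡ᵇ-false x≢a)

  countEq-insert : ∀ x a L → countEq x (insert a L) ≡ countEq x (a ∷ L)
  countEq-insert x a [] = refl
  countEq-insert x a (b ∷ L) with a ≤ᵇ b
  ... | true  = refl
  ... | false = trans (cong (_+_ (indicator x b)) (countEq-insert x a L))
                      (ℕ+.x∙yz≈y∙xz (indicator x b) (indicator x a) (countEq x L))

  countEq-sort : ∀ x L → countEq x (sort L) ≡ countEq x L
  countEq-sort x []      = refl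
  countEq-sort x (a ∷ L) = trans (countEq-insert x a (sort L)) (cong (_+_ (indicator x a)) (countEq-sort x L))

  length-insert : ∀ a L → length (insert a L) ≡ suc (length L)
  length-insert a [] = refl
  length-insert a (b ∷ L) with a ≤ᵇ b
  ... | true  = refl
  ... | false = cong suc (length-insert a L)

  length-sort : ∀ L → length (sort L) ≡ length L
  length-sort []      = refl
  length-sort (a ∷ L) = trans (length-insert a (sort L)) (cong suc (length-sort L))

  All-insert : ∀ {P : ℕ → Set} {a L} → P a → All P L → All P (insert a L)
  All-insert {L = []}        Pa []        = Pa ∷ []
  All-insert {a = a} {b ∷ L} Pa (Pb ∷ PL) with a ≤ᵇ b
  ... | true  = Pa ∷ Pb ∷ PL
  ... | false = Pb ∷ All-insert Pa PL

  All-sort : ∀ {P : ℕ → Set} {L} → All P L → All P (sort L)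
  All-sort []        = []
  All-sort (Pa ∷ PL) = All-insert Pa (All-sort PL)

  sorted-insert : ∀ a {L} → Sorted L → Sorted (insert a L)
  sorted-insert a {[]}    []              = [] ∷ []
  sorted-insert a {b ∷ L} (b≤L ∷ sorted) with a ≤ᵇ b in a≤ᵇb
  ... | true  = (a≤b ∷ ListAll.map (ℕ.≤-trans a≤b) b≤L) ∷ b≤L ∷ sorted
    where
    a≤b : a ≤ b
    a≤b = ℕ.≤ᵇ⇒≤ a b (subst T (sym a≤ᵇb) _)
  ... | false = All-insert b≤a b≤L ∷ sorted-insert a sorted
    where
    b≤a : b ≤ a
    b≤a = ℕ.<⇒≤ (ℕ.≰⇒> (λ a≤b → subst T a≤ᵇb (ℕ.≤⇒≤ᵇ a≤b)))

  sorted-sort : ∀ L → Sorted (sort L)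
  sorted-sort []      = []
  sorted-sort (a ∷ L) = sorted-insert a (sorted-sort L)

  countEq-pos : ∀ {P : ℕ → Set} x {L} → All P L → 1 ≤ countEq x L → P x
  countEq-pos x {a ∷ L} (Pa ∷ PL) 1≤count with x ℕ.≟ a
  ... | yes refl = Pa
  ... | no x≢a   = countEq-pos x PL (subst (λ c → 1 ≤ c + countEq x L) (indicator-≢ x≢a) 1≤count)

  countEq-head : ∀ x L → 1 ≤ countEq x (x ∷ L)
  countEq-head x L = subst (λ c → 1 ≤ c + countEq x L) (sym (indicator-refl x)) (s≤s z≤n)

  sorted-head≤ : ∀ {s S} x → All (s ≤_) S → 1 ≤ countEq x (s ∷ S) → s ≤ x
  sorted-head≤ {s} {S} x s≤S 1≤count with x ℕ.≟ s
  ... | yes refl = ℕ.≤-refl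
  ... | no x≢s   = countEq-pos x s≤S (subst (λ c → 1 ≤ c + countEq x S) (indicator-≢ x≢s) 1≤count)

  sorted-unique : ∀ {S T} → Sorted S → Sorted T → (∀ x → countEq x S ≡ countEq x T) → S ≡ T
  sorted-unique {[]}    {[]}    _ _ _    = refl
  sorted-unique {[]}    {t ∷ T} _ _ same = ⊥-elim (ℕ.1+n≰n (subst (1 ≤_) (sym (same t)) (countEq-head t T)))
  sorted-unique {s ∷ S} {[]}    _ _ same = ⊥-elim (ℕ.1+n≰n (subst (1 ≤_) (same s) (countEq-head s S)))
  sorted-unique {s ∷ S} {t ∷ T} (s≤S ∷ sortedS) (t≤T ∷ sortedT) same
    with ℕ.≤-antisym (sorted-head≤ t s≤S (subst (1 ≤_) (sym (same t)) (countEq-head t T)))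
                     (sorted-head≤ s t≤T (subst (1 ≤_) (same s) (countEq-head s S)))
  ... | refl = cong (s ∷_) (sorted-unique sortedS sortedT (λ x → ℕ.+-cancelˡ-≡ (indicator x s) _ _ (same x)))

  countEq-absent : ∀ x {L} → All (x ≢_) L → countEq x L ≡ 0
  countEq-absent x []            = refl
  countEq-absent x (x≢a ∷ x∉L) = cong₂ _+_ (indicator-≢ x≢a) (countEq-absent x x∉L)

  countEq-absent⁻ : ∀ x L → countEq x L ≡ 0 → All (x ≢_) L
  countEq-absent⁻ x []      _ = []
  countEq-absent⁻ x (a ∷ L) count≡0 with x ℕ.≟ a
  ... | yes refl = ⊥-elim (ℕ.1+n≢0 (trans (cong (_+ countEq x L) (sym (indicator-refl x))) count≡0))
  ... | no x≢a   = x≢a ∷ countEq-absent⁻ x L (trans (cong (_+ countEq x L) (sym (indicator-≢ x≢a))) count≡0)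

  Increasing : List ℕ → Set
  Increasing = AllPairs _<_

  increasing-countEq≤1 : ∀ x {L} → Increasing L → countEq x L ≤ 1
  increasing-countEq≤1 x {[]}    []                 = z≤n
  increasing-countEq≤1 x {a ∷ L} (a<L ∷ increasing) with x ℕ.≟ a
  ... | yes refl = ℕ.≤-reflexive (cong₂ _+_ (indicator-refl x) (countEq-absent x (ListAll.map ℕ.<⇒≢ a<L)))
  ... | no x≢a   = subst (λ c → c + countEq x L ≤ 1) (sym (indicator-≢ x≢a)) (increasing-countEq≤1 x increasing)

  strictlyIncreasing⇒increasing : ∀ {L} → T (strictlyIncreasing L) → Increasing L
  strictlyIncreasing⇒increasing {[]}         _  = []
  strictlyIncreasing⇒increasing {a ∷ []}     _  = [] ∷ []
  strictlyIncreasing⇒increasing {a ∷ b ∷ L} si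
    with strictlyIncreasing⇒increasing {b ∷ L} (proj₂ (Equivalence.to T-∧ si))
  ... | b<L ∷ increasing = (a<b ∷ ListAll.map (ℕ.<-trans a<b) b<L) ∷ b<L ∷ increasing
    where
    a<b : a < b
    a<b = ℕ.<ᵇ⇒< a b (proj₁ (Equivalence.to T-∧ si))

  increasing⇒strictlyIncreasing : ∀ {L} → Increasing L → T (strictlyIncreasing L)
  increasing⇒strictlyIncreasing {[]}         _ = _
  increasing⇒strictlyIncreasing {a ∷ []}     _ = _
  increasing⇒strictlyIncreasing {a ∷ b ∷ L} ((a<b ∷ _) ∷ increasing) =
    Equivalence.from T-∧ (ℕ.<⇒<ᵇ a<b , increasing⇒strictlyIncreasing increasing)

  record InA (l : ℕ) (w : Perm) (α : List ℕ) : Set where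
    field
      length≡    : T (length α ≡ᵇ l)
      increasing : T (strictlyIncreasing α)
      positive   : T (allPositive α)
      bounded    : T (pointwiseLeq α (wl l w))

  inA⁻ : ∀ {l w α} → T (inA l w α) → InA l w α
  inA⁻ {l} {w} {α} α∈A =
    let length≡ , rest₁    = Equivalence.to (T-∧ {length α ≡ᵇ l}) α∈A
        increasing , rest₂ = Equivalence.to (T-∧ {strictlyIncreasing α}) rest₁
        positive , bounded = Equivalence.to (T-∧ {allPositive α}) rest₂
    in record { length≡ = length≡ ; increasing = increasing ; positive = positive ; bounded = bounded }

  inA⁺ : ∀ {l w α} → InA l w α → T (inA l w α)
  inA⁺ {l} {w} {α} α∈A =
    Equivalence.from (T-∧ {length α ≡ᵇ l}) (length≡ ,
    Equivalence.from (T-∧ {strictlyIncreasing α}) (increasing ,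
    Equivalence.from (T-∧ {allPositive α}) (positive , bounded)))
    where open InA α∈A

  module Transposition (j : ℕ) where

    private
      i : ℕ
      i = suc j

    σ : ℕ → ℕ
    σ = swapℕ i

    σ-i : σ i ≡ suc i
    σ-i rewrite ≡ᵇ-true {i} refl = refl

    σ-suc-i : σ (suc i) ≡ i
    σ-suc-i rewrite ≡ᵇ-false (ℕ.1+n≢n {i}) | ≡ᵇ-true {i} refl = refl

    σ-other : ∀ {x} → x ≢ i → x ≢ suc i → σ x ≡ x
    σ-other x≢i x≢1+i rewrite ≡ᵇ-false x≢i | ≡ᵇ-false x≢1+i = refl

    σ-involutive : ∀ x → σ (σ x) ≡ x
    σ-involutive x with x ℕ.≟ i | x ℕ.≟ suc i
    ... | yes refl | _         = trans (cong σ σ-i) σ-suc-i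
    ... | no _     | yes refl  = trans (cong σ σ-suc-i) σ-i
    ... | no x≢i   | no x≢1+i = trans (cong σ (σ-other {x} x≢i x≢1+i)) (σ-other {x} x≢i x≢1+i)

    countEq-map-σ : ∀ x L → countEq x (map σ L) ≡ countEq (σ x) L
    countEq-map-σ x []      = refl
    countEq-map-σ x (a ∷ L) = cong₂ _+_ (indicator-σ a) (countEq-map-σ x L)
      where
      indicator-σ : ∀ a → indicator x (σ a) ≡ indicator (σ x) a
      indicator-σ a with x ℕ.≟ σ a
      ... | yes refl =
        trans (indicator-refl (σ a)) (sym (trans (cong (λ y → indicator y a) (σ-involutive a)) (indicator-refl a)))
      ... | no x≢σa  =
        trans (indicator-≢ x≢σa) (sym (indicator-≢ {σ x} {a} λ σx≡a → x≢σa (trans (sym (σ-involutive x)) (cong σ σx≡a))))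

    lower : ℕ → ℕ
    lower x = if x ≡ᵇ suc i then i else x

    lower-suc-i : lower (suc i) ≡ i
    lower-suc-i rewrite ≡ᵇ-true {suc i} refl = refl

    lower-other : ∀ {x} → x ≢ suc i → lower x ≡ x
    lower-other x≢1+i rewrite ≡ᵇ-false x≢1+i = refl

    lower-≤ : ∀ x → lower x ≤ x
    lower-≤ x with x ℕ.≟ suc i
    ... | yes refl   = subst (_≤ suc i) (sym lower-suc-i) (ℕ.n≤1+n i)
    ... | no x≢1+i = ℕ.≤-reflexive (lower-other x≢1+i)

    lower-positive : ∀ {x} → 0 < x → 0 < lower x
    lower-positive {x} 0<x with x ℕ.≟ suc i
    ... | yes refl   = subst (0 <_) (sym lower-suc-i) (s≤s z≤n)
    ... | no x≢1+i = subst (0 <_) (sym (lower-other x≢1+i)) 0<x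

    lower-< : ∀ {x y} → x < y → x ≢ i → lower x < lower y
    lower-< {x} {y} x<y x≢i with y ℕ.≟ suc i | x ℕ.≟ suc i
    ... | yes refl   | _          =
      subst₂ _<_ (sym (lower-other (ℕ.<⇒≢ x<y))) (sym lower-suc-i) (ℕ.≤∧≢⇒< (ℕ.≤-pred x<y) x≢i)
    ... | no y≢1+i | yes refl   =
      subst₂ _<_ (sym lower-suc-i) (sym (lower-other y≢1+i)) (ℕ.<-trans (ℕ.n<1+n i) x<y)
    ... | no y≢1+i | no x≢1+i = subst₂ _<_ (sym (lower-other x≢1+i)) (sym (lower-other y≢1+i)) x<y

    σ≡lower : ∀ {x} → i ≢ x → σ x ≡ lower x
    σ≡lower {x} i≢x with x ℕ.≟ suc i
    ... | yes refl   = trans σ-suc-i (sym lower-suc-i)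
    ... | no x≢1+i = trans (σ-other (i≢x ∘ sym) x≢1+i) (sym (lower-other x≢1+i))

    lower-increasing : ∀ {L} → Increasing L → All (i ≢_) L → Increasing (map lower L)
    lower-increasing {[]}    []                  []             = []
    lower-increasing {a ∷ L} (a<L ∷ increasing) (i≢a ∷ i∉L) =
      AllP.map⁺ (ListAll.map (λ a<y → lower-< a<y (i≢a ∘ sym)) a<L) ∷ lower-increasing increasing i∉L

    sSeq-fixed : ∀ {α} → Increasing α → countEq i α ≡ countEq (suc i) α → sSeq i α ≡ α
    sSeq-fixed {α} increasing same = sorted-unique (sorted-sort (map σ α)) (ListAllPairs.map ℕ.<⇒≤ increasing)
      (λ x → trans (countEq-sort x (map σ α)) (trans (countEq-map-σ x α) (σ-keeps-count x)))
      where
      σ-keeps-count : ∀ x → countEq (σ x) α ≡ countEq x α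
      σ-keeps-count x with x ℕ.≟ i | x ℕ.≟ suc i
      ... | yes refl | _          = trans (cong (λ y → countEq y α) σ-i) (sym same)
      ... | no _     | yes refl   = trans (cong (λ y → countEq y α) σ-suc-i) same
      ... | no x≢i   | no x≢1+i = cong (λ y → countEq y α) (σ-other {x} x≢i x≢1+i)

    sSeq-lowered : ∀ {α} → Increasing α → All (i ≢_) α → sSeq i α ≡ map lower α
    sSeq-lowered {α} increasing i∉α = trans (cong sort (List.map-cong-local (ListAll.map σ≡lower i∉α)))
      (sorted-unique (sorted-sort (map lower α)) (ListAllPairs.map ℕ.<⇒≤ (lower-increasing increasing i∉α))
                     (λ x → countEq-sort x (map lower α)))

    allPositive-lower : ∀ L → T (allPositive L) → T (allPositive (map lower L))
    allPositive-lower []      _   = _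
    allPositive-lower (a ∷ L) pos = Equivalence.from T-∧
      (ℕ.<⇒<ᵇ (lower-positive (ℕ.<ᵇ⇒< 0 a (proj₁ parts))) , allPositive-lower L (proj₂ parts))
      where
      parts : T (0 <ᵇ a) × T (allPositive L)
      parts = Equivalence.to T-∧ pos

    pointwiseLeq-lower : ∀ L W → T (pointwiseLeq L W) → T (pointwiseLeq (map lower L) W)
    pointwiseLeq-lower []      []      _  = _
    pointwiseLeq-lower (a ∷ L) (b ∷ W) le = Equivalence.from T-∧
      ( ℕ.≤⇒≤ᵇ (ℕ.≤-trans (lower-≤ a) (ℕ.≤ᵇ⇒≤ a b (proj₁ parts)))
      , pointwiseLeq-lower L W (proj₂ parts))
      where
      parts : T (a ≤ᵇ b) × T (pointwiseLeq L W)
      parts = Equivalence.to T-∧ le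

    lower-in-A : ∀ {l w α} → All (i ≢_) α → T (inA l w α) → T (inA l w (map lower α))
    lower-in-A {l} {w} {α} i∉α α∈A = inA⁺ {l} {w} {map lower α} (record
      { length≡    = subst (λ m → T (m ≡ᵇ l)) (sym (List.length-map lower α)) length≡
      ; increasing = increasing⇒strictlyIncreasing (lower-increasing (strictlyIncreasing⇒increasing increasing) i∉α)
      ; positive   = allPositive-lower α positive
      ; bounded    = pointwiseLeq-lower α (wl l w) bounded
      })
      where open InA (inA⁻ {l} {w} {α} α∈A)

    -- α ∈ A_l(w) with s_i α ∉ A_l(w) contains i but not i+1: otherwise s_i α is α itself,
    -- or is obtained from α by lowering i+1 to i, which stays in A_l(w).
    leaves-A : ∀ {l w α} → T (inA l w α) → ¬ T (inA l w (sSeq i α)) → countEq i α ≡ 1 × countEq (suc i) α ≡ 0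
    leaves-A {l} {w} {α} α∈A sα∉A =
      classify (ℕ.n≤1⇒n≡0∨n≡1 (increasing-countEq≤1 i increasing))
               (ℕ.n≤1⇒n≡0∨n≡1 (increasing-countEq≤1 (suc i) increasing))
      where
      increasing : Increasing α
      increasing = strictlyIncreasing⇒increasing (InA.increasing (inA⁻ {l} {w} {α} α∈A))

      stays-in-A : ∀ {β} → sSeq i α ≡ β → T (inA l w β) → ⊥
      stays-in-A sα≡β β∈A = sα∉A (subst (T ∘ inA l w) (sym sα≡β) β∈A)

      classify : countEq i α ≡ 0 ⊎ countEq i α ≡ 1 → countEq (suc i) α ≡ 0 ⊎ countEq (suc i) α ≡ 1 →
        countEq i α ≡ 1 × countEq (suc i) α ≡ 0
      classify (inj₂ cᵢ≡1) (inj₁ c′≡0) = cᵢ≡1 , c′≡0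
      classify (inj₁ cᵢ≡0) (inj₁ c′≡0) =
        ⊥-elim (stays-in-A (sSeq-fixed increasing (trans cᵢ≡0 (sym c′≡0))) α∈A)
      classify (inj₂ cᵢ≡1) (inj₂ c′≡1) =
        ⊥-elim (stays-in-A (sSeq-fixed increasing (trans cᵢ≡1 (sym c′≡1))) α∈A)
      classify (inj₁ cᵢ≡0) (inj₂ _) =
        ⊥-elim (stays-in-A (sSeq-lowered increasing i∉α) (lower-in-A i∉α α∈A))
        where
        i∉α : All (i ≢_) α
        i∉α = countEq-absent⁻ i α cᵢ≡0

  incSeqs-bounds : ∀ a k l → All (All (λ x → a ≤ x × x < a + k)) (incSeqs a k l)
  incSeqs-bounds a k       zero    = [] ∷ []
  incSeqs-bounds a zero    (suc l) = []
  incSeqs-bounds a (suc k) (suc l) = AllP.++⁺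
    (AllP.map⁺ (ListAll.map (λ bounds → (ℕ.≤-refl , ℕ.m<m+n a (s≤s z≤n)) ∷ ListAll.map widen bounds)
                            (incSeqs-bounds (suc a) k l)))
    (ListAll.map (ListAll.map widen) (incSeqs-bounds (suc a) k (suc l)))
    where
    widen : ∀ {x} → suc a ≤ x × x < suc a + k → a ≤ x × x < a + suc k
    widen {x} (a<x , x<a+k) = ℕ.<⇒≤ a<x , subst (x <_) (sym (ℕ.+-suc a k)) x<a+k

  lookup-xExp : ∀ L (p : Fin n) → lookup (xExp L) p ≡ countEq (suc (toℕ p)) L
  lookup-xExp L p = Vec.lookup∘tabulate _ p

  sum-xExp : ∀ {L} → All (λ x → 1 ≤ x × x ≤ n) L → sum (xExp {n} L) ≡ length L
  sum-xExp {n} {[]}    []                  = sum-tabulate-0 {n}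
  sum-xExp {n} {x ∷ L} ((1≤x , x≤n) ∷ bounds) = begin
    sum (xExp {n} (x ∷ L))                       ≡⟨ cong sum xExp-∷ ⟩
    sum (unitVec {n} x +ᵥ xExp L)                ≡⟨ sum-+ᵥ (unitVec {n} x) (xExp L) ⟩
    sum (unitVec {n} x) + sum (xExp {n} L)       ≡⟨ cong₂ _+_ (sum-unitVec {n} x 1≤x x≤n) (sum-xExp bounds) ⟩
    suc (length L)                               ∎
    where
    open ≡-Reasoning
    xExp-∷ : xExp {n} (x ∷ L) ≡ unitVec {n} x +ᵥ xExp L
    xExp-∷ = lookup-ext λ p → trans (lookup-xExp (x ∷ L) p)
      (sym (trans (lookup-+ᵥ (unitVec {n} x) (xExp L) p) (cong₂ _+_ (Vec.lookup∘tabulate _ p) (lookup-xExp L p))))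

module Factors {n} (j : ℕ) (1+j<n : suc j < n) (w : Perm) where
  open ListAll using ([]; _∷_)
  open Adjacent j 1+j<n
  open Steps j 1+j<n
  open Transposition j

  private
    i : ℕ
    i = suc j

  exit-shape : ∀ (r : Fin n) {α} → All (λ x → 1 ≤ x × x < 1 + n) α →
    T (inA (suc (toℕ r)) w α) → ¬ T (inA (suc (toℕ r)) w (sSeq i α)) → LinearShape r (xExp (sSeq i α))
  exit-shape r {α} bounds α∈A sα∉A = linearShape
    (λ p → subst (_≤ 1) (sym (counts p)) (increasing-countEq≤1 (σ (suc (toℕ p))) increasing))
    (begin
      sum (xExp {n} (sSeq i α)) ≡⟨ sum-xExp (All-sort (AllP.map⁺ (ListAll.map σ-bounds bounds))) ⟩
      length (sSeq i α)         ≡⟨ length-sort (map σ α) ⟩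
      length (map σ α)          ≡⟨ List.length-map σ α ⟩
      length α                  ≡⟨ ℕ.≡ᵇ⇒≡ _ _ (InA.length≡ α∈A′) ⟩
      suc (toℕ r)               ∎)
    (trans (counts ι) (trans (cong (λ x → countEq (σ (suc x)) α) toℕ-ι)
                             (trans (cong (λ x → countEq x α) σ-i) (proj₂ exits))))
    (trans (counts ι′) (trans (cong (λ x → countEq (σ (suc x)) α) toℕ-ι′)
                              (trans (cong (λ x → countEq x α) σ-suc-i) (proj₁ exits))))
    where
    open ≡-Reasoning
    α∈A′ : InA (suc (toℕ r)) w α
    α∈A′ = inA⁻ {suc (toℕ r)} {w} {α} α∈A
    increasing : Increasing α
    increasing = strictlyIncreasing⇒increasing (InA.increasing α∈A′)
    exits : countEq i α ≡ 1 × countEq (suc i) α ≡ 0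
    exits = leaves-A {suc (toℕ r)} {w} {α} α∈A sα∉A

    counts : ∀ p → lookup (xExp (sSeq i α)) p ≡ countEq (σ (suc (toℕ p))) α
    counts p = trans (lookup-xExp (sSeq i α) p) (trans (countEq-sort _ (map σ α)) (countEq-map-σ _ α))

    σ-bounds : ∀ {x} → 1 ≤ x × x < 1 + n → 1 ≤ σ x × σ x ≤ n
    σ-bounds {x} (1≤x , x<1+n) with x ℕ.≟ i | x ℕ.≟ suc i
    ... | yes refl | _          = subst (λ y → 1 ≤ y × y ≤ n) (sym σ-i) (s≤s z≤n , 1+j<n)
    ... | no _     | yes refl   = subst (λ y → 1 ≤ y × y ≤ n) (sym σ-suc-i) (s≤s z≤n , ℕ.<⇒≤ 1+j<n)
    ... | no x≢i   | no x≢1+i =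
      subst (λ y → 1 ≤ y × y ≤ n) (sym (σ-other {x} x≢i x≢1+i)) (1≤x , ℕ.≤-pred x<1+n)

  factor-shapes : ∀ (r : Fin n) → All (λ α → LinearShape r (xExp (sSeq i α))) (Ali n (suc (toℕ r)) w i)
  factor-shapes r = ListAll.map shape
    (ListAll.zip (AllP.all-filter _ (incSeqs 1 n l) , AllP.filter⁺ _ (incSeqs-bounds 1 n l)))
    where
    l : ℕ
    l = suc (toℕ r)
    shape : ∀ {α} → (inA l w α ∧ not (inA l w (sSeq i α))) ≡ true × All (λ x → 1 ≤ x × x < 1 + n) α →
      LinearShape r (xExp (sSeq i α))
    shape {α} (leaves , bounds) with Equivalence.to (T-∧ {inA l w α}) (Equivalence.from T-≡ leaves)
    ... | α∈A , sα∉A = exit-shape r bounds α∈A (λ sα∈A → subst T (Equivalence.to T-not-≡ sα∉A) sα∈A)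

  -- Nwi n w i unfolds to foldr block one (range 1 n).
  block : ℕ → Poly n → Poly n
  block l s = foldr (λ α s → (one ⊕ neg (term (+ 1) (xExp (sSeq i α)) (unitVec l))) ⊗ s) s (Ali n l w i)

  module _ (G : Mono n → ℤ) where

    block-shape : ∀ (r : Fin n) s → LowOrderShape LinearShape (convolve G s) →
      LowOrderShape LinearShape (convolve G (block (suc (toℕ r)) s))
    block-shape r s shape = factors (Ali n (suc (toℕ r)) w i) (factor-shapes r)
      where
      factor : List ℕ → Poly n → Poly n
      factor α s = (one ⊕ neg (term (+ 1) (xExp (sSeq i α)) (unitAt r))) ⊗ s
      factors : ∀ As → All (λ α → LinearShape r (xExp (sSeq i α))) As →
        LowOrderShape LinearShape (convolve G (foldr factor s As))
      factors []       []                = shape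
      factors (α ∷ As) (β-shape ∷ shapes) =
        lowOrderShape-cong (λ m → sym (convolve-factor G _ _ (foldr factor s As) m)) (factor-step (factors As shapes) β-shape)

    blocks-shape : ∀ k a → a + k ≤ n → LowOrderShape NoLinear G →
      LowOrderShape LinearShape (convolve G (foldr block one (range (suc a) k)))
    blocks-shape zero    a _        shape = lowOrderShape-cong (λ m → sym (convolve-one G m)) (lowOrderShape-noLinear shape)
    blocks-shape (suc k) a a+1+k≤n shape =
      subst (λ l → LowOrderShape LinearShape (convolve G (block l (foldr block one (range (suc (suc a)) k)))))
            (cong suc (Fin.toℕ-fromℕ< a<n))
            (block-shape (fromℕ< a<n) _ (blocks-shape k (suc a) (subst (_≤ n) (ℕ.+-suc a k) a+1+k≤n) shape))
      where
      a<n : a < n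
      a<n = ℕ.<-≤-trans (ℕ.m<m+n a (s≤s z≤n)) a+1+k≤n

  N-step : ∀ {P} → LowOrderShape NoLinear (coeff P) → LowOrderShape LinearShape (coeff (P ⊗ Nwi n w i))
  N-step {P} shape = lowOrderShape-cong (λ m → sym (coeff-⊗ P (Nwi n w i) m)) (blocks-shape (coeff P) n 0 ℕ.≤-refl shape)

builds-shape : ∀ {n w P} → BuildsP n w P → LowOrderShape NoLinear (coeff P)
builds-shape base = coeff-one
builds-shape (step zero () _ _ _ _)
builds-shape {n} (step {w} {P} {Q} (suc j) _ 1+j<n _ builds isPi) =
  Steps.pi-step j 1+j<n {P ⊗ Nwi n w (suc j)} {Q} isPi (Factors.N-step j 1+j<n w {P} (builds-shape builds))

at-≤ : ∀ {B} (a : Vec ℕ n) → (∀ p → lookup a p ≤ B) → ∀ k → at a k ≤ B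
at-≤ []ᵥ       _     _             = z≤n
at-≤ (x ∷ᵥ a) _     zero          = z≤n
at-≤ (x ∷ᵥ a) bound (suc zero)    = bound fzero
at-≤ (x ∷ᵥ a) bound (suc (suc k)) = at-≤ a (bound ∘ fsuc) (suc k)

ones+2twos≡sum : ∀ (a : Vec ℕ n) → (∀ p → lookup a p ≤ 2) → countVal 1 a + 2 * countVal 2 a ≡ sum a
ones+2twos≡sum []ᵥ       _     = refl
ones+2twos≡sum (x ∷ᵥ a) bound = begin
  (indicator 1 x + countVal 1 a) + 2 * (indicator 2 x + countVal 2 a)
    ≡⟨ cong (_+_ (indicator 1 x + countVal 1 a)) (ℕ.*-distribˡ-+ 2 (indicator 2 x) (countVal 2 a)) ⟩
  (indicator 1 x + countVal 1 a) + (2 * indicator 2 x + 2 * countVal 2 a)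
    ≡⟨ ℕ+.interchange (indicator 1 x) (countVal 1 a) (2 * indicator 2 x) (2 * countVal 2 a) ⟩
  (indicator 1 x + 2 * indicator 2 x) + (countVal 1 a + 2 * countVal 2 a)
    ≡⟨ cong₂ _+_ (entry (bound fzero)) (ones+2twos≡sum a (bound ∘ fsuc)) ⟩
  x + sum a ∎
  where
  open ≡-Reasoning
  entry : ∀ {x} → x ≤ 2 → indicator 1 x + 2 * indicator 2 x ≡ x
  entry z≤n             = refl
  entry (s≤s z≤n)       = refl
  entry (s≤s (s≤s z≤n)) = refl

quadraticShape-counts : ∀ {k l : Fin n} {a} → QuadraticShape k l a →
  allLeq2 a × countVal 2 a ≤ suc (toℕ k) × countVal 1 a + 2 * countVal 2 a ≡ suc (toℕ k) + suc (toℕ l)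
quadraticShape-counts {a = a} (quadraticShape entries≤2 twos≤ degree) =
  at-≤ a entries≤2 , twos≤ , trans (ones+2twos≡sum a entries≤2) degree

proposition3p10 : (n : ℕ) (w : Perm) (P : Poly n) → BuildsP n w P →
    (coeff P (zeros , zeros) ≡ + 1)
    × (∀ a → a ≢ zeros → coeff P (a , zeros) ≡ + 0)
    × (∀ a (k : Fin n) → coeff P (a , unitVec (suc (toℕ k))) ≡ + 0)
    × (∀ a (k l : Fin n) → toℕ k ≤ toℕ l → coeff P (a , TkTl k l) ≢ + 0 →
         allLeq2 a
         × countVal 2 a ≤ suc (toℕ k)
         × countVal 1 a + 2 * countVal 2 a ≡ suc (toℕ k) + suc (toℕ l))
proposition3p10 n w P builds =
  constant , pure-x , (λ a k → ≡0-stable (linear a k)) ,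
  λ a k l k≤l P≢0 → quadraticShape-counts (quadratic a k l k≤l P≢0)
  where open LowOrderShape (builds-shape builds)
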